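{- Assume Matiyasevich's conjecture: for every positive integer $n$, every recursively enumerable set $\mathcal{M}\subseteq \mathbb{N}^n$ has a finite-fold Diophantine representation. Then for every computable function $f:\mathbb{N}\to\mathbb{N}$ there is a positive integer $m(f)$ such that for each integer $n\ge m(f)$ there exists a system $S\subseteq E_n$ which has at least $f(n)$ and at most finitely many solutions in integers $x_1,\ldots,x_n$.
   Context: $\mathbb{N}=\{0,1,2,\ldots\}$. For a positive integer $n$, $E_n=\{x_i=1,\ x_i+x_j=x_k,\ x_i\cdot x_j=x_k:\ i,j,k\in\{1,\ldots,n\}\}$; a system $S\subseteq E_n$ is a set of such equations in the variables $x_1,\ldots,x_n$, and a solution is a tuple $(x_1,\ldots,x_n)$ satisfying all of them. A Diophantine representation of $\mathcal{M}\subseteq\mathbb{N}^n$ is a polynomial $W$ with integer coefficients such that for all $(a_1,\ldots,a_n)\in\mathbb{N}^n$: $(a_1,\ldots,a_n)\in\mathcal{M}\iff \exists x_1,\ldots,x_m\in\mathbb{N}\ W(a_1,\ldots,a_n,x_1,\ldots,x_m)=0$. It is finite-fold if for all $a_1,\ldots,a_n\in\mathbb{N}$ the equation $W(a_1,\ldots,a_n,x_1,\ldots,x_m)=0$ has at most finitely many solutions $(x_1,\ldots,x_m)\in\mathbb{N}^m$. -}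

module Defs where

open import Level using (0ℓ)
open import Data.Nat using (ℕ; zero; suc; _+_; _<_; _≤_)
open import Data.Integer as ℤ using (ℤ; +_)
open import Data.Fin using (Fin)
open import Data.Vec using (Vec; []; _∷_; _++_; lookup; map)
open import Data.List using (List; length)
open import Data.List.Relation.Unary.All using (All)
open import Data.List.Relation.Unary.Unique.Propositional using (Unique)
open import Data.List.Membership.Propositional using (_∈_)
open import Data.Product using (Σ; _×_; ∃)
open import Relation.Binary.PropositionalEquality using (_≡_)

data PR : ℕ → Set where
  zer  : ∀ {k} → PR k
  succ : PR 1
  proj : ∀ {k} → Fin k → PR k
  comp : ∀ {k l} → PR l → Vec (PR k) l → PR k
  prec : ∀ {k} → PR k → PR (suc (suc k)) → PR (suc k)  -- primitive recursion on 1st arg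
  mu   : ∀ {k} → PR (suc k) → PR k            -- unbounded minimisation on 1st arg

-- Big-step semantics:  Eval g xs v  means  g(xs) is defined and equals v.
mutual
  data Eval : ∀ {k} → PR k → Vec ℕ k → ℕ → Set where
    e-zer  : ∀ {k} {xs : Vec ℕ k} → Eval zer xs 0
    e-succ : ∀ {x} → Eval succ (x ∷ []) (suc x)
    e-proj : ∀ {k} {i : Fin k} {xs} → Eval (proj i) xs (lookup xs i)
    e-comp : ∀ {k l} {g : PR l} {hs : Vec (PR k) l} {xs ys v} →
             EvalAll hs xs ys → Eval g ys v → Eval (comp g hs) xs v
    e-prec0 : ∀ {k} {g : PR k} {h} {xs v} →
              Eval g xs v → Eval (prec g h) (0 ∷ xs) v
    e-precS : ∀ {k} {g : PR k} {h} {n xs u v} →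
              Eval (prec g h) (n ∷ xs) u → Eval h (n ∷ u ∷ xs) v →
              Eval (prec g h) (suc n ∷ xs) v
    e-mu   : ∀ {k} {g : PR (suc k)} {xs n} →
             Eval g (n ∷ xs) 0 →
             (∀ j → j < n → ∃ λ v → Eval g (j ∷ xs) (suc v)) →
             Eval (mu g) xs n

  data EvalAll : ∀ {k l} → Vec (PR k) l → Vec ℕ k → Vec ℕ l → Set where
    [] : ∀ {k} {xs : Vec ℕ k} → EvalAll [] xs []
    _∷_ : ∀ {k l} {h : PR k} {hs : Vec (PR k) l} {xs y ys} →
          Eval h xs y → EvalAll hs xs ys → EvalAll (h ∷ hs) xs (y ∷ ys)

Computable : (ℕ → ℕ) → Set
Computable f = Σ (PR 1) λ g → ∀ x → Eval g (x ∷ []) (f x)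

RecEnum : (n : ℕ) → (Vec ℕ n → Set) → Set
RecEnum n M = Σ (PR n) λ g → ∀ a → (M a → ∃ λ v → Eval g a v) × ((∃ λ v → Eval g a v) → M a)

data Poly (k : ℕ) : Set where
  var  : Fin k → Poly k
  con  : ℤ → Poly k
  _⊕_  : Poly k → Poly k → Poly k
  _⊗_  : Poly k → Poly k → Poly k

evalP : ∀ {k} → Poly k → Vec ℤ k → ℤ
evalP (var i) env = lookup env i
evalP (con c) env = c
evalP (p ⊕ q) env = evalP p env ℤ.+ evalP q env
evalP (p ⊗ q) env = evalP p env ℤ.* evalP q env

evalℕ : ∀ {n m} → Poly (n + m) → Vec ℕ n → Vec ℕ m → ℤ
evalℕ W a x = evalP W (map +_ (a ++ x))

DiophRep : (n m : ℕ) → (Vec ℕ n → Set) → Poly (n + m) → Set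
DiophRep n m M W = ∀ a → (M a → ∃ λ x → evalℕ W a x ≡ + 0) × ((∃ λ x → evalℕ W a x ≡ + 0) → M a)

FiniteFold : (n m : ℕ) → Poly (n + m) → Set
FiniteFold n m W = ∀ a → Σ (List (Vec ℕ m)) λ L → ∀ x → evalℕ W a x ≡ + 0 → x ∈ L

MatiyasevichConjecture : Set₁
MatiyasevichConjecture =
  ∀ n → 1 ≤ n → (M : Vec ℕ n → Set) → RecEnum n M →
  Σ ℕ λ m → Σ (Poly (n + m)) λ W → DiophRep n m M W × FiniteFold n m W

data Eqn (n : ℕ) : Set where
  one : Fin n → Eqn n
  add : Fin n → Fin n → Fin n → Eqn n
  mul : Fin n → Fin n → Fin n → Eqn n

System : ℕ → Set
System n = List (Eqn n)

SatEq : ∀ {n} → Vec ℤ n → Eqn n → Set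
SatEq x (one i)     = lookup x i ≡ + 1
SatEq x (add i j k) = lookup x i ℤ.+ lookup x j ≡ lookup x k
SatEq x (mul i j k) = lookup x i ℤ.* lookup x j ≡ lookup x k

IsSol : ∀ {n} → System n → Vec ℤ n → Set
IsSol S x = All (SatEq x) S

AtLeastSols : ∀ {n} → ℕ → System n → Set
AtLeastSols {n} c S = Σ (List (Vec ℤ n)) λ L → Unique L × c ≤ length L × All (IsSol S) L

FinitelyManySols : ∀ {n} → System n → Set
FinitelyManySols {n} S = Σ (List (Vec ℤ n)) λ L → ∀ x → IsSol S x → x ∈ L

module Submission where

open import Defs
open import Data.Nat using (ℕ; _≤_)
open import Data.Product using (Σ; _×_)

-- The conjecture gives a finite-fold representation W(a, b, x⃗) of the graph
-- b = f(a), which is recursively enumerable (module GraphRecEnum).  Systems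
-- are built as straight-line programs (StraightLine): each new variable is
-- free or defined from earlier ones by one equation, so a bound on the free
-- variables bounds every solution, and free values extend to solutions.
-- Natural unknowns are sums of four integer squares (Gadgets): by Lagrange's
-- theorem (FourSquares, via Euler's descent) all naturals occur, each with
-- finitely many roots.  W is compiled into equations (Compile), a counting
-- chain forces a = n, and checks impose W(n, b, x⃗) = 0 (so b = f(n)) and
-- z + w = b.  Hence z ranges over 0 … f(n), while all variables stay bounded
-- by a function of n, f(n) and the finitely many witnesses x⃗ (Systems turns
-- this into a finite list of vectors).

module FourSquares where
  open import Data.Integer as ℤ using (ℤ; +_; -[1+_]; ∣_∣)
  import Data.Integer.Properties as ℤP
  open import Data.Product using (Σ; _,_; _×_; proj₁; proj₂)
  open import Relation.Binary.PropositionalEquality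

  module IntegerIdentities where
    open import Data.Integer using (_+_; _*_; _-_)
    open import Data.Integer.Tactic.RingSolver using (solve-∀)
    open ≡-Reasoning

    sumSqℤ : ℤ → ℤ → ℤ → ℤ → ℤ
    sumSqℤ a b c d = a * a + b * b + c * c + d * d

    sumSqℤ-cong : ∀ {a b c d a′ b′ c′ d′} → a ≡ a′ → b ≡ b′ → c ≡ c′ → d ≡ d′ →
                  sumSqℤ a b c d ≡ sumSqℤ a′ b′ c′ d′
    sumSqℤ-cong refl refl refl refl = refl

    -- The four coordinates of the quaternion product of (a,b,c,d) and (e,f,g,h).
    euler₁ euler₂ euler₃ euler₄ : ℤ → ℤ → ℤ → ℤ → ℤ → ℤ → ℤ → ℤ → ℤ
    euler₁ a b c d e f g h = a * e + b * f + c * g + d * h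
    euler₂ a b c d e f g h = a * f - b * e + c * h - d * g
    euler₃ a b c d e f g h = a * g - b * h - c * e + d * f
    euler₄ a b c d e f g h = a * h + b * g - c * f - d * e

    euler : ∀ a b c d e f g h →
      sumSqℤ a b c d * sumSqℤ e f g h ≡
      sumSqℤ (euler₁ a b c d e f g h) (euler₂ a b c d e f g h)
             (euler₃ a b c d e f g h) (euler₄ a b c d e f g h)
    euler = expanded
      where
      expanded : ∀ a b c d e f g h →
        (a * a + b * b + c * c + d * d) * (e * e + f * f + g * g + h * h) ≡
        (a * e + b * f + c * g + d * h) * (a * e + b * f + c * g + d * h) +
        (a * f - b * e + c * h - d * g) * (a * f - b * e + c * h - d * g) +
        (a * g - b * h - c * e + d * f) * (a * g - b * h - c * e + d * f) +
        (a * h + b * g - c * f - d * e) * (a * h + b * g - c * f - d * e)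
      expanded = solve-∀

    sumSqℤ-scale : ∀ M a b c d → sumSqℤ (M * a) (M * b) (M * c) (M * d) ≡ M * M * sumSqℤ a b c d
    sumSqℤ-scale = expanded
      where
      expanded : ∀ M a b c d →
        M * a * (M * a) + M * b * (M * b) + M * c * (M * c) + M * d * (M * d) ≡
        M * M * (a * a + b * b + c * c + d * d)
      expanded = solve-∀

    crossTerm : ℤ → ℤ → ℤ → ℤ → ℤ → ℤ → ℤ → ℤ → ℤ → ℤ
    crossTerm M qa qb qc qd e f g h =
      M * sumSqℤ qa qb qc qd + euler₁ qa qb qc qd e f g h + euler₁ qa qb qc qd e f g h

    sumSqℤ-shift : ∀ M qa qb qc qd e f g h →
      sumSqℤ (M * qa + e) (M * qb + f) (M * qc + g) (M * qd + h) ≡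
      M * crossTerm M qa qb qc qd e f g h + sumSqℤ e f g h
    sumSqℤ-shift = expanded
      where
      expanded : ∀ M qa qb qc qd e f g h →
        (M * qa + e) * (M * qa + e) + (M * qb + f) * (M * qb + f) +
        (M * qc + g) * (M * qc + g) + (M * qd + h) * (M * qd + h) ≡
        M * (M * (qa * qa + qb * qb + qc * qc + qd * qd) +
             (qa * e + qb * f + qc * g + qd * h) + (qa * e + qb * f + qc * g + qd * h)) +
        (e * e + f * f + g * g + h * h)
      expanded = solve-∀

    reducedSum : ∀ M P qa qb qc qd e f g h →
      M * P ≡ sumSqℤ (M * qa + e) (M * qb + f) (M * qc + g) (M * qd + h) →
      M * (P - crossTerm M qa qb qc qd e f g h) ≡ sumSqℤ e f g h
    reducedSum M P qa qb qc qd e f g h MP≡ = begin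
      M * (P - C)                    ≡⟨ distrib M P C ⟩
      M * P - M * C                  ≡⟨ cong (_- M * C) MP≡ ⟩
      sumSqℤ x₁ x₂ x₃ x₄ - M * C     ≡⟨ cong (_- M * C) (sumSqℤ-shift M qa qb qc qd e f g h) ⟩
      M * C + sumSqℤ e f g h - M * C ≡⟨ cancel (M * C) (sumSqℤ e f g h) ⟩
      sumSqℤ e f g h                 ∎
      where
      C x₁ x₂ x₃ x₄ : ℤ
      C = crossTerm M qa qb qc qd e f g h
      x₁ = M * qa + e ; x₂ = M * qb + f ; x₃ = M * qc + g ; x₄ = M * qd + h
      distrib : ∀ M P C → M * (P - C) ≡ M * P - M * C
      distrib = solve-∀
      cancel : ∀ u v → u + v - u ≡ v
      cancel = solve-∀

    euler₁-shift : ∀ M qa qb qc qd e f g h →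
      euler₁ (M * qa + e) (M * qb + f) (M * qc + g) (M * qd + h) e f g h ≡
      M * euler₁ qa qb qc qd e f g h + sumSqℤ e f g h
    euler₁-shift = expanded
      where
      expanded : ∀ M qa qb qc qd e f g h →
        (M * qa + e) * e + (M * qb + f) * f + (M * qc + g) * g + (M * qd + h) * h ≡
        M * (qa * e + qb * f + qc * g + qd * h) + (e * e + f * f + g * g + h * h)
      expanded = solve-∀

    euler₂-shift : ∀ M qa qb qc qd e f g h →
      euler₂ (M * qa + e) (M * qb + f) (M * qc + g) (M * qd + h) e f g h ≡
      M * euler₂ qa qb qc qd e f g h
    euler₂-shift = expanded
      where
      expanded : ∀ M qa qb qc qd e f g h →
        (M * qa + e) * f - (M * qb + f) * e + (M * qc + g) * h - (M * qd + h) * g ≡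
        M * (qa * f - qb * e + qc * h - qd * g)
      expanded = solve-∀

    euler₃-shift : ∀ M qa qb qc qd e f g h →
      euler₃ (M * qa + e) (M * qb + f) (M * qc + g) (M * qd + h) e f g h ≡
      M * euler₃ qa qb qc qd e f g h
    euler₃-shift = expanded
      where
      expanded : ∀ M qa qb qc qd e f g h →
        (M * qa + e) * g - (M * qb + f) * h - (M * qc + g) * e + (M * qd + h) * f ≡
        M * (qa * g - qb * h - qc * e + qd * f)
      expanded = solve-∀

    euler₄-shift : ∀ M qa qb qc qd e f g h →
      euler₄ (M * qa + e) (M * qb + f) (M * qc + g) (M * qd + h) e f g h ≡
      M * euler₄ qa qb qc qd e f g h
    euler₄-shift = expanded
      where
      expanded : ∀ M qa qb qc qd e f g h →
        (M * qa + e) * h + (M * qb + f) * g - (M * qc + g) * f - (M * qd + h) * e ≡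
        M * (qa * h + qb * g - qc * f - qd * e)
      expanded = solve-∀

    -- Heart of the descent: if Σ eᵢ² = M R, then Euler's identity applied to
    -- (M qᵢ + eᵢ)ᵢ and (eᵢ)ᵢ yields a representation divisible by M².
    eulerDivided : ∀ M qa qb qc qd e f g h R → M * R ≡ sumSqℤ e f g h →
      M * M * sumSqℤ (euler₁ qa qb qc qd e f g h + R) (euler₂ qa qb qc qd e f g h)
                     (euler₃ qa qb qc qd e f g h) (euler₄ qa qb qc qd e f g h) ≡
      sumSqℤ (M * qa + e) (M * qb + f) (M * qc + g) (M * qd + h) * (M * R)
    eulerDivided M qa qb qc qd e f g h R MR≡Y = begin
      M * M * sumSqℤ (t₁ + R) t₂ t₃ t₄
        ≡⟨ sym (sumSqℤ-scale M (t₁ + R) t₂ t₃ t₄) ⟩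
      sumSqℤ (M * (t₁ + R)) (M * t₂) (M * t₃) (M * t₄)
        ≡⟨ sumSqℤ-cong first (sym (euler₂-shift M qa qb qc qd e f g h))
                       (sym (euler₃-shift M qa qb qc qd e f g h)) (sym (euler₄-shift M qa qb qc qd e f g h)) ⟩
      sumSqℤ (euler₁ x₁ x₂ x₃ x₄ e f g h) (euler₂ x₁ x₂ x₃ x₄ e f g h)
             (euler₃ x₁ x₂ x₃ x₄ e f g h) (euler₄ x₁ x₂ x₃ x₄ e f g h)
        ≡⟨ sym (euler x₁ x₂ x₃ x₄ e f g h) ⟩
      sumSqℤ x₁ x₂ x₃ x₄ * sumSqℤ e f g h
        ≡⟨ cong (sumSqℤ x₁ x₂ x₃ x₄ *_) (sym MR≡Y) ⟩
      sumSqℤ x₁ x₂ x₃ x₄ * (M * R) ∎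
      where
      t₁ t₂ t₃ t₄ x₁ x₂ x₃ x₄ : ℤ
      t₁ = euler₁ qa qb qc qd e f g h ; t₂ = euler₂ qa qb qc qd e f g h
      t₃ = euler₃ qa qb qc qd e f g h ; t₄ = euler₄ qa qb qc qd e f g h
      x₁ = M * qa + e ; x₂ = M * qb + f ; x₃ = M * qc + g ; x₄ = M * qd + h
      first : M * (t₁ + R) ≡ euler₁ x₁ x₂ x₃ x₄ e f g h
      first = begin
        M * (t₁ + R)           ≡⟨ ℤP.*-distribˡ-+ M t₁ R ⟩
        M * t₁ + M * R         ≡⟨ cong (λ u → M * t₁ + u) MR≡Y ⟩
        M * t₁ + sumSqℤ e f g h ≡⟨ sym (euler₁-shift M qa qb qc qd e f g h) ⟩
        euler₁ x₁ x₂ x₃ x₄ e f g h ∎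

    interchange : ∀ M P R → M * P * (M * R) ≡ M * M * (R * P)
    interchange = solve-∀

    -- Rounding the quotient up in the balanced division below.
    shiftQuotient : ∀ M R Q → R + Q * M ≡ M * (+ 1 + Q) + (R - M)
    shiftQuotient = solve-∀

  open IntegerIdentities

  open import Data.Nat as ℕ using (ℕ; zero; suc; _+_; _*_; _∸_; _≤_; _<_; _≤?_; z≤n; s≤s)
  import Data.Nat.Properties as ℕP
  open import Data.Nat.DivMod using (_/_; _%_; m≡m%n+[m/n]*n; m%n<n)
  open import Data.Nat.Divisibility using (_∣_; divides; ∣m+n∣m⇒∣n; ∣⇒≤; n∣m*n)
  open import Data.Nat.Primality
    using (Prime; prime?; euclidsLemma; prime⇒irreducible; ¬prime⇒composite; composite)
  open import Data.Nat.Base using (nonTrivial⇒n>1)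
  open import Data.Nat.Induction using (<-rec)
  open import Data.Nat.Tactic.RingSolver using (solve-∀)
  open import Data.Fin using (Fin; toℕ; fromℕ<)
  import Data.Fin.Properties as FinP
  open import Data.Sum using (inj₁; inj₂; _⊎_)
  open import Data.Empty using (⊥; ⊥-elim)
  open import Relation.Nullary using (yes; no; Dec; ¬_)

  sumSq : ℕ → ℕ → ℕ → ℕ → ℕ
  sumSq a b c d = a * a + b * b + c * c + d * d

  IsSumOf4Squares : ℕ → Set
  IsSumOf4Squares n = Σ ℕ λ a → Σ ℕ λ b → Σ ℕ λ c → Σ ℕ λ d → n ≡ sumSq a b c d

  sumSq-pos : ∀ a b c d → + sumSq a b c d ≡ sumSqℤ (+ a) (+ b) (+ c) (+ d)
  sumSq-pos a b c d =
    trans (ℤP.pos-+ (a * a + b * b + c * c) (d * d))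
    (cong₂ ℤ._+_ (trans (ℤP.pos-+ (a * a + b * b) (c * c))
      (cong₂ ℤ._+_ (trans (ℤP.pos-+ (a * a) (b * b)) (cong₂ ℤ._+_ (ℤP.pos-* a a) (ℤP.pos-* b b)))
                   (ℤP.pos-* c c)))
      (ℤP.pos-* d d))

  sq-abs : ∀ x → x ℤ.* x ≡ + (∣ x ∣) ℤ.* + (∣ x ∣)
  sq-abs (+ n)    = refl
  sq-abs -[1+ n ] = refl

  sumSqℤ-abs : ∀ a b c d → sumSqℤ a b c d ≡ + sumSq (∣ a ∣) (∣ b ∣) (∣ c ∣) (∣ d ∣)
  sumSqℤ-abs a b c d =
    trans (cong₂ ℤ._+_ (cong₂ ℤ._+_ (cong₂ ℤ._+_ (sq-abs a) (sq-abs b)) (sq-abs c)) (sq-abs d))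
          (sym (sumSq-pos (∣ a ∣) (∣ b ∣) (∣ c ∣) (∣ d ∣)))

  fromIntegerSquares : ∀ n a b c d → + n ≡ sumSqℤ a b c d → IsSumOf4Squares n
  fromIntegerSquares n a b c d eq =
    ∣ a ∣ , ∣ b ∣ , ∣ c ∣ , ∣ d ∣ , ℤP.+-injective (trans eq (sumSqℤ-abs a b c d))

  sumOf4Squares-* : ∀ m n → IsSumOf4Squares m → IsSumOf4Squares n → IsSumOf4Squares (m * n)
  sumOf4Squares-* _ _ (a , b , c , d , refl) (e , f , g , h , refl) =
    fromIntegerSquares _ (euler₁ A B C D E F G H) (euler₂ A B C D E F G H)
                         (euler₃ A B C D E F G H) (euler₄ A B C D E F G H)
      (trans (ℤP.pos-* (sumSq a b c d) (sumSq e f g h))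
      (trans (cong₂ ℤ._*_ (sumSq-pos a b c d) (sumSq-pos e f g h)) (euler A B C D E F G H)))
    where
    A B C D E F G H : ℤ
    A = + a ; B = + b ; C = + c ; D = + d ; E = + e ; F = + f ; G = + g ; H = + h

  parity : ∀ a → Σ ℕ λ α → Σ ℕ λ e → e ≤ 1 × a ≡ α + α + e
  parity zero          = 0 , 0 , z≤n , refl
  parity (suc zero)    = 0 , 1 , s≤s z≤n , refl
  parity (suc (suc a)) with parity a
  ... | α , e , e≤1 , refl = suc α , e , e≤1 , cong suc (cong (_+ e) (sym (ℕP.+-suc α α)))

  double-injective : ∀ x y → x + x ≡ y + y → x ≡ y
  double-injective x y eq = ℕP.*-cancelˡ-≡ x y 2 (trans (twice x) (trans eq (sym (twice y))))
    where twice : ∀ x → 2 * x ≡ x + x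
          twice = solve-∀

  even≢odd : ∀ x y → x + x ≢ suc (y + y)
  even≢odd zero    y       ()
  even≢odd (suc x) zero    eq = ℕP.1+n≢0 (trans (sym (ℕP.+-suc x x)) (ℕP.suc-injective eq))
  even≢odd (suc x) (suc y) eq =
    even≢odd x y (ℕP.suc-injective (trans (sym (ℕP.+-suc x x))
                                   (trans (ℕP.suc-injective eq) (cong suc (ℕP.+-suc y y)))))

  -- Two squares of the same parity sum to twice a sum of two squares:
  -- (2α+e)² + (2β+e)² = 2((α+β+e)² + (α−β)²).
  twiceSumSq : ℕ → ℕ → ℕ
  twiceSumSq u v = (u * u + v * v) + (u * u + v * v)

  sameParityPair : ∀ α β e → Σ ℕ λ u → Σ ℕ λ v →
    (α + α + e) * (α + α + e) + (β + β + e) * (β + β + e) ≡ twiceSumSq u v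
  sameParityPair α β e with ℕP.≤-total β α
  ... | inj₁ β≤α =
    β + t + β + e , t ,
    subst (λ z → (z + z + e) * (z + z + e) + (β + β + e) * (β + β + e) ≡ twiceSumSq (β + t + β + e) t)
          (ℕP.m+[n∸m]≡n β≤α) (identity β t e)
    where
    t : ℕ
    t = α ∸ β
    identity : ∀ β t e → (β + t + (β + t) + e) * (β + t + (β + t) + e) + (β + β + e) * (β + β + e) ≡
      ((β + t + β + e) * (β + t + β + e) + t * t) + ((β + t + β + e) * (β + t + β + e) + t * t)
    identity = solve-∀
  ... | inj₂ α≤β =
    α + t + α + e , t ,
    subst (λ z → (α + α + e) * (α + α + e) + (z + z + e) * (z + z + e) ≡ twiceSumSq (α + t + α + e) t)
          (ℕP.m+[n∸m]≡n α≤β) (identity α t e)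
    where
    t : ℕ
    t = β ∸ α
    identity : ∀ α t e → (α + α + e) * (α + α + e) + (α + t + (α + t) + e) * (α + t + (α + t) + e) ≡
      ((α + t + α + e) * (α + t + α + e) + t * t) + ((α + t + α + e) * (α + t + α + e) + t * t)
    identity = solve-∀

  oddEvenSq : ℕ → ℕ → ℕ
  oddEvenSq α e = (α + α + e) * (α + α + e)

  halvePairs : ∀ N e e′ α β γ δ →
    N + N ≡ oddEvenSq α e + oddEvenSq β e + oddEvenSq γ e′ + oddEvenSq δ e′ → IsSumOf4Squares N
  halvePairs N e e′ α β γ δ eq with sameParityPair α β e | sameParityPair γ δ e′
  ... | u , v , uv | s , t , st = u , v , s , t ,
    double-injective N _ (trans eq (trans (ℕP.+-assoc (oddEvenSq α e + oddEvenSq β e) _ _)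
      (trans (cong₂ _+_ uv st) (regroup u v s t))))
    where
    regroup : ∀ u v s t → u * u + v * v + (u * u + v * v) + (s * s + t * t + (s * s + t * t))
                         ≡ u * u + v * v + s * s + t * t + (u * u + v * v + s * s + t * t)
    regroup = solve-∀

  -- Σ (2αᵢ + eᵢ)² = 2·G + Σ eᵢ², so the parities eᵢ must have an even sum.
  module ParityCases where
    G : ℕ → ℕ → ℕ → ℕ → ℕ → ℕ → ℕ → ℕ → ℕ
    G α β γ δ ea eb ec ed = α * α + α * α + α * ea + α * ea + (β * β + β * β + β * eb + β * eb) +
                            (γ * γ + γ * γ + γ * ec + γ * ec) + (δ * δ + δ * δ + δ * ed + δ * ed)

    expand : ∀ α β γ δ ea eb ec ed →
      oddEvenSq α ea + oddEvenSq β eb + oddEvenSq γ ec + oddEvenSq δ ed ≡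
      G α β γ δ ea eb ec ed + G α β γ δ ea eb ec ed + (ea * ea + eb * eb + ec * ec + ed * ed)
    expand = expanded
      where
      expanded : ∀ α β γ δ ea eb ec ed →
        (α + α + ea) * (α + α + ea) + (β + β + eb) * (β + β + eb) +
        (γ + γ + ec) * (γ + γ + ec) + (δ + δ + ed) * (δ + δ + ed) ≡
        (α * α + α * α + α * ea + α * ea + (β * β + β * β + β * eb + β * eb) +
         (γ * γ + γ * γ + γ * ec + γ * ec) + (δ * δ + δ * δ + δ * ed + δ * ed)) +
        (α * α + α * α + α * ea + α * ea + (β * β + β * β + β * eb + β * eb) +
         (γ * γ + γ * γ + γ * ec + γ * ec) + (δ * δ + δ * δ + δ * ed + δ * ed)) +
        (ea * ea + eb * eb + ec * ec + ed * ed)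
      expanded = solve-∀

    notOne : ∀ N g → N + N ≢ g + g + 1
    notOne N g eq = even≢odd N g (trans eq (ℕP.+-comm (g + g) 1))

    notThree : ∀ N g → N + N ≢ g + g + 3
    notThree N g eq = even≢odd N (suc g) (trans eq (shift g))
      where shift : ∀ g → g + g + 3 ≡ suc (suc g + suc g)
            shift = solve-∀

    swap₂₃ : ∀ A B C D → A + B + C + D ≡ A + C + B + D
    swap₂₃ = solve-∀

    swap₂₄ : ∀ A B C D → A + B + C + D ≡ A + D + B + C
    swap₂₄ = solve-∀

    -- All sixteen parity patterns: eight pair up, eight have an odd total.
    halveByParity : ∀ N α β γ δ ea eb ec ed → ea ≤ 1 → eb ≤ 1 → ec ≤ 1 → ed ≤ 1 →
      N + N ≡ oddEvenSq α ea + oddEvenSq β eb + oddEvenSq γ ec + oddEvenSq δ ed → IsSumOf4Squares N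
    halveByParity N α β γ δ 0 0 0 0 _ _ _ _ eq = halvePairs N 0 0 α β γ δ eq
    halveByParity N α β γ δ 0 0 1 1 _ _ _ _ eq = halvePairs N 0 1 α β γ δ eq
    halveByParity N α β γ δ 1 1 0 0 _ _ _ _ eq = halvePairs N 1 0 α β γ δ eq
    halveByParity N α β γ δ 1 1 1 1 _ _ _ _ eq = halvePairs N 1 1 α β γ δ eq
    halveByParity N α β γ δ 0 1 0 1 _ _ _ _ eq =
      halvePairs N 0 1 α γ β δ (trans eq (swap₂₃ (oddEvenSq α 0) (oddEvenSq β 1) (oddEvenSq γ 0) (oddEvenSq δ 1)))
    halveByParity N α β γ δ 1 0 1 0 _ _ _ _ eq =
      halvePairs N 1 0 α γ β δ (trans eq (swap₂₃ (oddEvenSq α 1) (oddEvenSq β 0) (oddEvenSq γ 1) (oddEvenSq δ 0)))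
    halveByParity N α β γ δ 0 1 1 0 _ _ _ _ eq =
      halvePairs N 0 1 α δ β γ (trans eq (swap₂₄ (oddEvenSq α 0) (oddEvenSq β 1) (oddEvenSq γ 1) (oddEvenSq δ 0)))
    halveByParity N α β γ δ 1 0 0 1 _ _ _ _ eq =
      halvePairs N 1 0 α δ β γ (trans eq (swap₂₄ (oddEvenSq α 1) (oddEvenSq β 0) (oddEvenSq γ 0) (oddEvenSq δ 1)))
    halveByParity N α β γ δ 0 0 0 1 _ _ _ _ eq = ⊥-elim (notOne N (G α β γ δ 0 0 0 1) (trans eq (expand α β γ δ 0 0 0 1)))
    halveByParity N α β γ δ 0 0 1 0 _ _ _ _ eq = ⊥-elim (notOne N (G α β γ δ 0 0 1 0) (trans eq (expand α β γ δ 0 0 1 0)))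
    halveByParity N α β γ δ 0 1 0 0 _ _ _ _ eq = ⊥-elim (notOne N (G α β γ δ 0 1 0 0) (trans eq (expand α β γ δ 0 1 0 0)))
    halveByParity N α β γ δ 1 0 0 0 _ _ _ _ eq = ⊥-elim (notOne N (G α β γ δ 1 0 0 0) (trans eq (expand α β γ δ 1 0 0 0)))
    halveByParity N α β γ δ 1 1 1 0 _ _ _ _ eq = ⊥-elim (notThree N (G α β γ δ 1 1 1 0) (trans eq (expand α β γ δ 1 1 1 0)))
    halveByParity N α β γ δ 1 1 0 1 _ _ _ _ eq = ⊥-elim (notThree N (G α β γ δ 1 1 0 1) (trans eq (expand α β γ δ 1 1 0 1)))
    halveByParity N α β γ δ 1 0 1 1 _ _ _ _ eq = ⊥-elim (notThree N (G α β γ δ 1 0 1 1) (trans eq (expand α β γ δ 1 0 1 1)))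
    halveByParity N α β γ δ 0 1 1 1 _ _ _ _ eq = ⊥-elim (notThree N (G α β γ δ 0 1 1 1) (trans eq (expand α β γ δ 0 1 1 1)))
    halveByParity N α β γ δ (suc (suc _)) _ _ _ (s≤s ()) _ _ _ _
    halveByParity N α β γ δ _ (suc (suc _)) _ _ _ (s≤s ()) _ _ _
    halveByParity N α β γ δ _ _ (suc (suc _)) _ _ _ (s≤s ()) _ _
    halveByParity N α β γ δ _ _ _ (suc (suc _)) _ _ _ (s≤s ()) _

  halve : ∀ N a b c d → N + N ≡ sumSq a b c d → IsSumOf4Squares N
  halve N a b c d eq with parity a | parity b | parity c | parity d
  ... | α , ea , la , refl | β , eb , lb , refl | γ , ec , lc , refl | δ , ed , ld , refl =
    ParityCases.halveByParity N α β γ δ ea eb ec ed la lb lc ld eq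

  -- For an odd prime p = 2h+1 there are x, y ≤ h with p ∣ x² + y² + 1.
  -- The h+1 values x² mod p are distinct, as are the h+1 values
  -- (p−1) − (y² mod p); by pigeonhole the two families meet.

  module MinusOneSumOfTwoSquares (h : ℕ) (prime-p : Prime (suc (h + h))) where
    p : ℕ
    p = suc (h + h)

    sameRemainder⇒∣ : ∀ a D → (a + D) % p ≡ a % p → p ∣ D
    sameRemainder⇒∣ a D eq = ∣m+n∣m⇒∣n {p} {(a / p) * p} {D} divisible (n∣m*n (a / p))
      where
      open ≡-Reasoning
      regroup : ∀ X D r → X + D + r ≡ (r + X) + D
      regroup = solve-∀
      split : (a / p) * p + D + a % p ≡ ((a + D) / p) * p + a % p
      split = begin
        (a / p) * p + D + a % p           ≡⟨ regroup (a / p * p) D (a % p) ⟩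
        (a % p + (a / p) * p) + D         ≡⟨ cong (_+ D) (sym (m≡m%n+[m/n]*n a p)) ⟩
        a + D                             ≡⟨ m≡m%n+[m/n]*n (a + D) p ⟩
        (a + D) % p + ((a + D) / p) * p   ≡⟨ cong (_+ ((a + D) / p) * p) eq ⟩
        a % p + ((a + D) / p) * p         ≡⟨ ℕP.+-comm (a % p) _ ⟩
        ((a + D) / p) * p + a % p         ∎
      divisible : p ∣ (a / p) * p + D
      divisible = divides ((a + D) / p) (ℕP.+-cancelʳ-≡ (a % p) _ _ split)

    ∤-small : ∀ n → 0 < n → n < p → p ∣ n → ⊥
    ∤-small (suc n) _ n<p p∣n = ℕP.<-irrefl refl (ℕP.<-≤-trans n<p (∣⇒≤ p∣n))

    squares-distinct : ∀ x y → x < y → y ≤ h → (x * x) % p ≡ (y * y) % p → ⊥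
    squares-distinct x y x<y y≤h eq with euclidsLemma (y ∸ x) (x + y) prime-p p∣
      where
      d : ℕ
      d = y ∸ x
      y≡ : y ≡ x + d
      y≡ = sym (ℕP.m+[n∸m]≡n (ℕP.<⇒≤ x<y))
      expand : ∀ x d → (x + d) * (x + d) ≡ x * x + d * (x + (x + d))
      expand = solve-∀
      p∣ : p ∣ d * (x + y)
      p∣ = sameRemainder⇒∣ (x * x) (d * (x + y))
        (trans (cong (_% p) (sym (trans (cong (λ t → t * t) y≡)
                 (trans (expand x d) (cong (λ t → x * x + d * (x + t)) (sym y≡)))))) (sym eq))
    ... | inj₁ p∣d = ∤-small (y ∸ x) (ℕP.m<n⇒0<n∸m x<y)
           (ℕP.≤-<-trans (ℕP.m∸n≤m y x) (s≤s (ℕP.≤-trans y≤h (ℕP.m≤m+n h h)))) p∣d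
    ... | inj₂ p∣s = ∤-small (x + y) (ℕP.<-≤-trans (s≤s z≤n) (ℕP.≤-trans x<y (ℕP.m≤n+m y x)))
           (s≤s (ℕP.+-mono-≤ (ℕP.≤-trans (ℕP.<⇒≤ x<y) y≤h) y≤h)) p∣s

    value : ∀ t → Dec (t ≤ h) → ℕ
    value t (yes _) = (t * t) % p
    value t (no _)  = (h + h) ∸ (((t ∸ suc h) * (t ∸ suc h)) % p)

    value<p : ∀ t d → value t d < p
    value<p t (yes _) = m%n<n (t * t) p
    value<p t (no _)  = s≤s (ℕP.m∸n≤m (h + h) (((t ∸ suc h) * (t ∸ suc h)) % p))

    valueMap : Fin (suc h + suc h) → Fin p
    valueMap i = fromℕ< (value<p (toℕ i) (toℕ i ≤? h))

    complementary⇒∣ : ∀ x y → (x * x) % p ≡ (h + h) ∸ ((y * y) % p) → p ∣ x * x + y * y + 1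
    complementary⇒∣ x y eq = divides (suc (q₁ + q₂)) (begin
        x * x + y * y + 1                  ≡⟨ cong₂ (λ u v → u + v + 1) (m≡m%n+[m/n]*n (x * x) p)
                                                                         (m≡m%n+[m/n]*n (y * y) p) ⟩
        (r₁ + q₁ * p) + (r₂ + q₂ * p) + 1  ≡⟨ regroup r₁ q₁ r₂ q₂ p ⟩
        suc (r₁ + r₂) + (q₁ + q₂) * p      ≡⟨ cong (λ t → suc t + (q₁ + q₂) * p) r₁+r₂ ⟩
        p + (q₁ + q₂) * p                  ∎)
      where
      open ≡-Reasoning
      r₁ r₂ q₁ q₂ : ℕ
      r₁ = (x * x) % p ; r₂ = (y * y) % p ; q₁ = x * x / p ; q₂ = y * y / p
      regroup : ∀ r₁ q₁ r₂ q₂ p → (r₁ + q₁ * p) + (r₂ + q₂ * p) + 1 ≡ suc (r₁ + r₂) + (q₁ + q₂) * p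
      regroup = solve-∀
      r₁+r₂ : r₁ + r₂ ≡ h + h
      r₁+r₂ = trans (cong (_+ r₂) eq) (ℕP.m∸n+n≡m (ℕ.s≤s⁻¹ (m%n<n (y * y) p)))

    Witness : Set
    Witness = Σ ℕ λ x → Σ ℕ λ y → x ≤ h × y ≤ h × p ∣ x * x + y * y + 1

    upperHalf≤h : ∀ t → t < suc h + suc h → ¬ t ≤ h → t ∸ suc h ≤ h
    upperHalf≤h t t< t≰h = ℕP.+-cancelˡ-≤ (suc h) _ _
      (ℕP.≤-trans (ℕP.≤-reflexive (ℕP.m+[n∸m]≡n (ℕP.≰⇒> t≰h)))
                  (ℕP.≤-trans (ℕ.s≤s⁻¹ t<) (ℕP.≤-reflexive (ℕP.+-suc h h))))

    fromCollision : ∀ s t → s < t → t < suc h + suc h → value s (s ≤? h) ≡ value t (t ≤? h) → Witness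
    fromCollision s t s<t t< eq with s ≤? h | t ≤? h
    ... | yes s≤h | yes t≤h = ⊥-elim (squares-distinct s t s<t t≤h eq)
    ... | yes s≤h | no t≰h  = s , t ∸ suc h , s≤h , upperHalf≤h t t< t≰h , complementary⇒∣ s (t ∸ suc h) eq
    ... | no s≰h  | yes t≤h = ⊥-elim (ℕP.<-irrefl refl (ℕP.<-≤-trans (ℕP.≰⇒> s≰h) (ℕP.≤-trans (ℕP.<⇒≤ s<t) t≤h)))
    ... | no s≰h  | no t≰h  = ⊥-elim (squares-distinct u v u<v (upperHalf≤h t t< t≰h)
            (ℕP.∸-cancelˡ-≡ (ℕ.s≤s⁻¹ (m%n<n (u * u) p)) (ℕ.s≤s⁻¹ (m%n<n (v * v) p)) eq))
      where
      u v : ℕ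
      u = s ∸ suc h
      v = t ∸ suc h
      u<v : u < v
      u<v = ℕP.+-cancelˡ-< (suc h) _ _
        (subst₂ _<_ (sym (ℕP.m+[n∸m]≡n (ℕP.≰⇒> s≰h))) (sym (ℕP.m+[n∸m]≡n (ℕP.≰⇒> t≰h))) s<t)

    witness : Witness
    witness with FinP.pigeonhole (s≤s (ℕP.≤-reflexive (sym (ℕP.+-suc h h)))) valueMap
    ... | i , j , i<j , same = fromCollision (toℕ i) (toℕ j) i<j (FinP.toℕ<n j)
      (trans (sym (FinP.toℕ-fromℕ< (value<p (toℕ i) (toℕ i ≤? h))))
      (trans (cong toℕ same) (FinP.toℕ-fromℕ< (value<p (toℕ j) (toℕ j ≤? h)))))

  balancedRemainder : ∀ k x → Σ ℤ λ q → Σ ℤ λ y → (+ x ≡ + suc (k + k) ℤ.* q ℤ.+ y) × ∣ y ∣ ≤ k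
  balancedRemainder k x with x % suc (k + k) ℕ.≤? k
  ... | yes r≤k = + (x / m) , + (x % m) , eq , r≤k
    where
    m : ℕ
    m = suc (k + k)
    eq : + x ≡ + m ℤ.* + (x / m) ℤ.+ + (x % m)
    eq = trans (cong +_ (trans (m≡m%n+[m/n]*n x m) (ℕP.+-comm (x % m) _)))
           (trans (ℤP.pos-+ ((x / m) * m) (x % m))
             (cong (ℤ._+ + (x % m)) (trans (ℤP.pos-* (x / m) m) (ℤP.*-comm (+ (x / m)) (+ m)))))
  ... | no r≰k = + suc (x / m) , + (x % m) ℤ.- + m , eq , bound
    where
    m : ℕ
    m = suc (k + k)
    r<m : x % m < m
    r<m = m%n<n x m
    eq : + x ≡ + m ℤ.* + suc (x / m) ℤ.+ (+ (x % m) ℤ.- + m)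
    eq = trans (cong +_ (m≡m%n+[m/n]*n x m))
           (trans (ℤP.pos-+ (x % m) ((x / m) * m))
           (trans (cong (λ t → + (x % m) ℤ.+ t) (ℤP.pos-* (x / m) m))
             (shiftQuotient (+ m) (+ (x % m)) (+ (x / m)))))
    bound : ∣ + (x % m) ℤ.- + m ∣ ≤ k
    bound rewrite ℤP.m-n≡m⊖n (x % m) m | ℤP.∣⊖∣-< r<m =
      ℕP.+-cancelˡ-≤ (x % m) _ _ (ℕP.≤-trans (ℕP.≤-reflexive (ℕP.m+[n∸m]≡n (ℕP.<⇒≤ r<m)))
         (ℕP.+-monoˡ-≤ k (ℕP.≰⇒> r≰k)))

  reducedSum<square : ∀ k (e f g h : ℤ) → ∣ e ∣ ≤ k → ∣ f ∣ ≤ k → ∣ g ∣ ≤ k → ∣ h ∣ ≤ k →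
    sumSq (∣ e ∣) (∣ f ∣) (∣ g ∣) (∣ h ∣) < suc (k + k) * suc (k + k)
  reducedSum<square k e f g h be bf bg bh =
    ℕP.≤-<-trans (ℕP.+-mono-≤ (ℕP.+-mono-≤ (ℕP.+-mono-≤ (sq≤ be) (sq≤ bf)) (sq≤ bg)) (sq≤ bh))
      (ℕP.≤-trans (s≤s (ℕP.m≤m+n _ (k + k + k + k))) (ℕP.≤-reflexive (expand k)))
    where
    sq≤ : ∀ {x} → x ≤ k → x * x ≤ k * k
    sq≤ x≤k = ℕP.*-mono-≤ x≤k x≤k
    expand : ∀ k → suc (k * k + k * k + k * k + k * k + (k + k + k + k)) ≡ suc (k + k) * suc (k + k)
    expand = solve-∀

  naturalQuotient : ∀ n m (R : ℤ) → + n ≡ + suc m ℤ.* R → Σ ℕ λ r → R ≡ + r × n ≡ suc m * r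
  naturalQuotient n m (+ r)    eq = r , refl , ℤP.+-injective (trans eq (sym (ℤP.pos-* (suc m) r)))
  naturalQuotient n m -[1+ r ] ()

  sumSq≡0 : ∀ a b c d → sumSq a b c d ≡ 0 → a ≡ 0 × b ≡ 0 × c ≡ 0 × d ≡ 0
  sumSq≡0 zero    zero    zero    zero    _ = refl , refl , refl , refl
  sumSq≡0 (suc _) _       _       _       ()
  sumSq≡0 zero    (suc _) _       _       ()
  sumSq≡0 zero    zero    (suc _) _       ()
  sumSq≡0 zero    zero    zero    (suc _) ()

  exactMultiple : ∀ m x q (y : ℤ) → + x ≡ + m ℤ.* q ℤ.+ y → ∣ y ∣ ≡ 0 → x ≡ m * (∣ q ∣)
  exactMultiple m x q (+ zero)    eq _  = trans (cong ∣_∣ (trans eq (ℤP.+-identityʳ (+ m ℤ.* q)))) (ℤP.abs-* (+ m) q)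
  exactMultiple m x q (+ suc _)   eq ()
  exactMultiple m x q -[1+ _ ]    eq ()

  commonFactor : ∀ m p a b c d → m * p ≡ sumSq (m * a) (m * b) (m * c) (m * d) → m ≢ 0 → m ∣ p
  commonFactor m p a b c d eq m≢0 =
    divides (sumSq a b c d) (ℕP.*-cancelˡ-≡ p (sumSq a b c d * m) m {{ℕ.≢-nonZero m≢0}}
      (trans eq (factor m a b c d)))
    where
    factor : ∀ m a b c d → sumSq (m * a) (m * b) (m * c) (m * d) ≡ m * (sumSq a b c d * m)
    factor = expanded
      where
      expanded : ∀ m a b c d → m * a * (m * a) + m * b * (m * b) + m * c * (m * c) + m * d * (m * d)
                                ≡ m * ((a * a + b * b + c * c + d * d) * m)
      expanded = solve-∀

  -- Euler's descent step: from (2k+1) p = Σ aᵢ² with 1 < 2k+1 < p, produce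
  -- r p = Σ wᵢ² with 1 ≤ r < 2k+1.  Reduce aᵢ to balanced remainders eᵢ;
  -- then Σ eᵢ² = m r, and Euler's identity divided by m² gives r p.
  oddDescentStep : ∀ p k → Prime p → 1 ≤ k → suc (k + k) < p → IsSumOf4Squares (suc (k + k) * p) →
    Σ ℕ λ r → 1 ≤ r × r < suc (k + k) × IsSumOf4Squares (r * p)
  oddDescentStep p k prime-p 1≤k m<p (a , b , c , d , mp≡)
    with balancedRemainder k a | balancedRemainder k b | balancedRemainder k c | balancedRemainder k d
  ... | qa , e , a≡ , e≤k | qb , f , b≡ , f≤k | qc , g , c≡ , g≤k | qd , h , d≡ , h≤k =
    r , ℕP.n≢0⇒n>0 r≢0 , r<m , fromIntegerSquares (r * p) W₁ W₂ W₃ W₄ rp≡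
    where
    m : ℕ
    m = suc (k + k)
    M P : ℤ
    M = + m
    P = + p
    mp≡ℤ : M ℤ.* P ≡ sumSqℤ (M ℤ.* qa ℤ.+ e) (M ℤ.* qb ℤ.+ f) (M ℤ.* qc ℤ.+ g) (M ℤ.* qd ℤ.+ h)
    mp≡ℤ = trans (sym (ℤP.pos-* m p)) (trans (cong +_ mp≡) (trans (sumSq-pos a b c d) (sumSqℤ-cong a≡ b≡ c≡ d≡)))
    R : ℤ
    R = P ℤ.- crossTerm M qa qb qc qd e f g h
    MR≡ : M ℤ.* R ≡ sumSqℤ e f g h
    MR≡ = reducedSum M P qa qb qc qd e f g h mp≡ℤ
    Y : ℕ
    Y = sumSq (∣ e ∣) (∣ f ∣) (∣ g ∣) (∣ h ∣)
    quotient : Σ ℕ λ r → R ≡ + r × Y ≡ m * r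
    quotient = naturalQuotient Y (k + k) R (trans (sym (sumSqℤ-abs e f g h)) (sym MR≡))
    r : ℕ
    r = proj₁ quotient
    Y≡mr : Y ≡ m * r
    Y≡mr = proj₂ (proj₂ quotient)
    r<m : r < m
    r<m = ℕP.*-cancelˡ-< m r m (subst (_< m * m) Y≡mr (reducedSum<square k e f g h e≤k f≤k g≤k h≤k))
    -- r = 0 would force all eᵢ = 0, making m a proper divisor of the prime p.
    m∣p-if-r≡0 : r ≡ 0 → m ∣ p
    m∣p-if-r≡0 r≡0 =
      commonFactor m p (∣ qa ∣) (∣ qb ∣) (∣ qc ∣) (∣ qd ∣)
        (trans mp≡ (cong₂ _+_ (cong₂ _+_ (cong₂ _+_ (square (exactMultiple m a qa e a≡ e≡0))
                                                   (square (exactMultiple m b qb f b≡ f≡0)))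
                                        (square (exactMultiple m c qc g c≡ g≡0)))
                             (square (exactMultiple m d qd h d≡ h≡0))))
        (λ ())
      where
      zeros : ∣ e ∣ ≡ 0 × ∣ f ∣ ≡ 0 × ∣ g ∣ ≡ 0 × ∣ h ∣ ≡ 0
      zeros = sumSq≡0 (∣ e ∣) (∣ f ∣) (∣ g ∣) (∣ h ∣) (trans Y≡mr (trans (cong (m *_) r≡0) (ℕP.*-zeroʳ m)))
      e≡0 : ∣ e ∣ ≡ 0
      e≡0 = proj₁ zeros
      f≡0 : ∣ f ∣ ≡ 0
      f≡0 = proj₁ (proj₂ zeros)
      g≡0 : ∣ g ∣ ≡ 0
      g≡0 = proj₁ (proj₂ (proj₂ zeros))
      h≡0 : ∣ h ∣ ≡ 0
      h≡0 = proj₂ (proj₂ (proj₂ zeros))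
      square : ∀ {x y} → x ≡ y → x * x ≡ y * y
      square eq = cong₂ _*_ eq eq
    notProperDivisor : m ≡ 1 ⊎ m ≡ p → ⊥
    notProperDivisor (inj₁ m≡1) = ℕP.<⇒≢ 1≤k (sym (ℕP.m+n≡0⇒m≡0 k (ℕP.suc-injective m≡1)))
    notProperDivisor (inj₂ m≡p) = ℕP.<-irrefl m≡p m<p
    r≢0 : r ≢ 0
    r≢0 r≡0 = notProperDivisor (prime⇒irreducible prime-p (m∣p-if-r≡0 r≡0))
    W₁ W₂ W₃ W₄ : ℤ
    W₁ = euler₁ qa qb qc qd e f g h ℤ.+ R
    W₂ = euler₂ qa qb qc qd e f g h
    W₃ = euler₃ qa qb qc qd e f g h
    W₄ = euler₄ qa qb qc qd e f g h
    rp≡ : + (r * p) ≡ sumSqℤ W₁ W₂ W₃ W₄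
    rp≡ = trans (ℤP.pos-* r p) (trans (cong (ℤ._* P) (sym (proj₁ (proj₂ quotient))))
            (sym (ℤP.*-cancelˡ-≡ (M ℤ.* M) _ _
              (trans (eulerDivided M qa qb qc qd e f g h R MR≡)
              (trans (cong (ℤ._* (M ℤ.* R)) (sym mp≡ℤ)) (interchange M P R))))))

  -- Descent: if m p is a sum of four squares for some 1 ≤ m < p, so is p.
  -- Even multipliers are halved, odd ones are reduced by the descent step.
  descent : ∀ p → Prime p → ∀ m → 1 ≤ m → m < p → IsSumOf4Squares (m * p) → IsSumOf4Squares p
  descent p prime-p = <-rec (λ m → 1 ≤ m → m < p → IsSumOf4Squares (m * p) → IsSumOf4Squares p) step
    where
    step : ∀ m → (∀ {k} → k < m → 1 ≤ k → k < p → IsSumOf4Squares (k * p) → IsSumOf4Squares p) →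
           1 ≤ m → m < p → IsSumOf4Squares (m * p) → IsSumOf4Squares p
    step m rec 1≤m m<p mp with parity m
    ... | α , 0 , _ , m≡ = rec α<m 1≤α (ℕP.<-trans α<m m<p) αp
      where
      m≡2α : m ≡ α + α
      m≡2α = trans m≡ (ℕP.+-identityʳ (α + α))
      1≤α : 1 ≤ α
      1≤α = ℕP.n≢0⇒n>0 (λ α≡0 → ℕP.<⇒≢ 1≤m (sym (trans m≡2α (cong (λ t → t + t) α≡0))))
      α<m : α < m
      α<m = subst (α <_) (sym m≡2α) (ℕP.m<m+n α 1≤α)
      αp : IsSumOf4Squares (α * p)
      αp = let (a , b , c , d , eq) = mp in
        halve (α * p) a b c d (trans (sym (ℕP.*-distribʳ-+ p α α)) (trans (cong (_* p) (sym m≡2α)) eq))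
    ... | zero , 1 , _ , refl = subst IsSumOf4Squares (ℕP.*-identityˡ p) mp
    ... | suc α , 1 , _ , m≡ =
      continue (oddDescentStep p (suc α) prime-p (s≤s z≤n) (subst (_< p) m≡odd m<p)
                               (subst (λ t → IsSumOf4Squares (t * p)) m≡odd mp))
      where
      m≡odd : m ≡ suc (suc α + suc α)
      m≡odd = trans m≡ (ℕP.+-comm (suc α + suc α) 1)
      continue : Σ ℕ (λ r → 1 ≤ r × r < suc (suc α + suc α) × IsSumOf4Squares (r * p)) → IsSumOf4Squares p
      continue (r , 1≤r , r<m , rp) = rec r<m′ 1≤r (ℕP.<-trans r<m′ m<p) rp
        where
        r<m′ : r < m
        r<m′ = subst (r <_) (sym m≡odd) r<m
    ... | _ , suc (suc _) , s≤s () , _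

  -- An odd prime p = 2h+1: some multiple k p = x² + y² + 1 with k < p starts the descent.
  oddPrime : ∀ h → Prime (suc (h + h)) → 1 ≤ h → IsSumOf4Squares (suc (h + h))
  oddPrime h prime-p 1≤h with MinusOneSumOfTwoSquares.witness h prime-p
  ... | x , y , x≤h , y≤h , divides k eq =
    descent p prime-p k 1≤k k<p (x , y , 1 , 0 , trans (sym eq) (pad x y))
    where
    p : ℕ
    p = suc (h + h)
    pad : ∀ x y → x * x + y * y + 1 ≡ x * x + y * y + 1 * 1 + 0 * 0
    pad = solve-∀
    1≤k : 1 ≤ k
    1≤k = ℕP.n≢0⇒n>0 (λ k≡0 → ℕP.1+n≢0 (trans (ℕP.+-comm 1 (x * x + y * y)) (trans eq (cong (_* p) k≡0))))
    small : x * x + y * y + 1 < p * p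
    small = ℕP.≤-<-trans (ℕP.+-monoˡ-≤ 1 (ℕP.+-mono-≤ (ℕP.*-mono-≤ x≤h x≤h) (ℕP.*-mono-≤ y≤h y≤h)))
              (subst (h * h + h * h + 1 <_) (sym (expand h)) (ℕP.m<m+n _ (ℕP.<-≤-trans 1≤h (ℕP.m≤m+n h _))))
      where
      expand : ∀ h → suc (h + h) * suc (h + h) ≡ (h * h + h * h + 1) + (h + (h + h + h + (h * h + h * h)))
      expand = solve-∀
    k<p : k < p
    k<p = ℕP.*-cancelʳ-< p k p (subst (_< p * p) eq small)

  primeIsSumOf4Squares : ∀ p → Prime p → IsSumOf4Squares p
  primeIsSumOf4Squares p prime-p with parity p
  ... | α , 0 , _ , p≡ = subst IsSumOf4Squares (sym p≡2) (1 , 1 , 0 , 0 , refl)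
    where
    2∣p : 2 ∣ p
    2∣p = divides α (trans p≡ (trans (ℕP.+-identityʳ (α + α)) (double α)))
      where double : ∀ α → α + α ≡ α * 2
            double = solve-∀
    p≡2 : p ≡ 2
    p≡2 with prime⇒irreducible prime-p 2∣p
    ... | inj₁ ()
    ... | inj₂ 2≡p = sym 2≡p
  ... | zero , 1 , _ , refl with prime-p
  ... | ()
  primeIsSumOf4Squares p prime-p | suc h , 1 , _ , p≡ =
    subst IsSumOf4Squares (sym p≡odd) (oddPrime (suc h) (subst Prime p≡odd prime-p) (s≤s z≤n))
    where
    p≡odd : p ≡ suc (suc h + suc h)
    p≡odd = trans p≡ (ℕP.+-comm (suc h + suc h) 1)
  primeIsSumOf4Squares p prime-p | _ , suc (suc _) , s≤s () , _

  -- It is only used as a theorem,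
  -- so it is kept abstract to stop type checking from unfolding the proof.
  abstract
    lagrange : ∀ n → IsSumOf4Squares n
    lagrange = <-rec IsSumOf4Squares step
      where
      step : ∀ n → (∀ {k} → k < n → IsSumOf4Squares k) → IsSumOf4Squares n
      step zero _ = 0 , 0 , 0 , 0 , refl
      step (suc zero) _ = 1 , 0 , 0 , 0 , refl
      step n@(suc (suc _)) rec with prime? n
      ... | yes prime-n = primeIsSumOf4Squares n prime-n
      ... | no ¬prime with ¬prime⇒composite ¬prime
      ... | composite {d} d<n (divides q eq) =
        subst IsSumOf4Squares (sym eq) (sumOf4Squares-* q d (rec q<n) (rec d<n))
        where
        q≢0 : q ≢ 0
        q≢0 refl = ℕP.1+n≢0 eq
        q<n : q < n
        q<n = subst (q <_) (sym eq) (ℕP.m<m*n q d {{ℕ.≢-nonZero q≢0}} (nonTrivial⇒n>1 d))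

module GraphRecEnum where
  open import Data.Nat as ℕ using (ℕ; zero; suc; _+_; _∸_)
  import Data.Nat.Properties as ℕP
  open import Data.Fin using () renaming (zero to fz; suc to fs)
  open import Data.Vec using (Vec; []; _∷_)
  open import Data.Product using (_,_; ∃; proj₁; proj₂)
  open import Data.Empty using (⊥-elim)
  open import Relation.Binary.PropositionalEquality
  open import Relation.Binary.Definitions using (tri<; tri≈; tri>)

  mutual
    eval-deterministic : ∀ {k} {g : PR k} {xs v w} → Eval g xs v → Eval g xs w → v ≡ w
    eval-deterministic e-zer e-zer = refl
    eval-deterministic e-succ e-succ = refl
    eval-deterministic e-proj e-proj = refl
    eval-deterministic (e-comp args body) (e-comp args′ body′) with evalAll-deterministic args args′
    ... | refl = eval-deterministic body body′
    eval-deterministic (e-prec0 base) (e-prec0 base′) = eval-deterministic base base′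
    eval-deterministic (e-precS rec step) (e-precS rec′ step′) with eval-deterministic rec rec′
    ... | refl = eval-deterministic step step′
    -- Two minimisation results n, n′: the smaller one is a zero of g, yet
    -- lies below the other and is therefore a non-zero value of g.
    eval-deterministic (e-mu {n = n} atN below) (e-mu {n = n′} atN′ below′) with ℕP.<-cmp n n′
    ... | tri< n<n′ _ _ = ⊥-elim (ℕP.0≢1+n (eval-deterministic atN (proj₂ (below′ n n<n′))))
    ... | tri≈ _ n≡n′ _ = n≡n′
    ... | tri> _ _ n′<n = ⊥-elim (ℕP.0≢1+n (eval-deterministic atN′ (proj₂ (below n′ n′<n))))

    evalAll-deterministic : ∀ {k l} {hs : Vec (PR k) l} {xs ys ys′} →
                            EvalAll hs xs ys → EvalAll hs xs ys′ → ys ≡ ys′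
    evalAll-deterministic [] [] = refl
    evalAll-deterministic (e ∷ es) (e′ ∷ es′) = cong₂ _∷_ (eval-deterministic e e′) (evalAll-deterministic es es′)

  predPR : PR 1
  predPR = prec zer (proj fz)

  eval-pred : ∀ x → Eval predPR (x ∷ []) (ℕ.pred x)
  eval-pred zero    = e-prec0 e-zer
  eval-pred (suc x) = e-precS (eval-pred x) e-proj

  -- monusPR (y, x) = x ∸ y
  monusPR : PR 2
  monusPR = prec (proj fz) (comp predPR (proj (fs fz) ∷ []))

  eval-monus : ∀ y x → Eval monusPR (y ∷ x ∷ []) (x ∸ y)
  eval-monus zero    x = e-prec0 e-proj
  eval-monus (suc y) x = subst (Eval monusPR (suc y ∷ x ∷ [])) (ℕP.pred[m∸n]≡m∸[1+n] x y)
    (e-precS (eval-monus y x) (e-comp (e-proj ∷ []) (eval-pred (x ∸ y))))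

  addPR : PR 2
  addPR = prec (proj fz) (comp succ (proj (fs fz) ∷ []))

  eval-add : ∀ y x → Eval addPR (y ∷ x ∷ []) (y + x)
  eval-add zero    x = e-prec0 e-proj
  eval-add (suc y) x = e-precS (eval-add y x) (e-comp (e-proj ∷ []) e-succ)

  -- The graph { (a, b) : b = f a } of a computable function is recursively
  -- enumerable: it is the domain of  (a, b) ↦ μz. |f a − b|.
  module Graph (f : ℕ → ℕ) (computable : Computable f) where
    private
      g : PR 1
      g = proj₁ computable
      eval-g : ∀ x → Eval g (x ∷ []) (f x)
      eval-g = proj₂ computable

    graph : Vec ℕ 2 → Set
    graph (a ∷ b ∷ []) = b ≡ f a

    -- distancePR (z, a, b) = (f a ∸ b) + (b ∸ f a), ignoring z
    distancePR : PR 3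
    distancePR = comp addPR (comp monusPR (argB ∷ fA ∷ []) ∷ comp monusPR (fA ∷ argB ∷ []) ∷ [])
      where
      fA argB : PR 3
      fA   = comp g (proj (fs fz) ∷ [])
      argB = proj (fs (fs fz))

    eval-distance : ∀ z a b → Eval distancePR (z ∷ a ∷ b ∷ []) ((f a ∸ b) + (b ∸ f a))
    eval-distance z a b =
      e-comp (e-comp (e-proj ∷ e-comp (e-proj ∷ []) (eval-g a) ∷ []) (eval-monus b (f a))
            ∷ e-comp (e-comp (e-proj ∷ []) (eval-g a) ∷ e-proj ∷ []) (eval-monus (f a) b) ∷ [])
             (eval-add (f a ∸ b) (b ∸ f a))

    graph-recEnum : RecEnum 2 graph
    graph-recEnum = mu distancePR , λ { (a ∷ b ∷ []) → halts a b , onGraph a b }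
      where
      halts : ∀ a b → b ≡ f a → ∃ λ v → Eval (mu distancePR) (a ∷ b ∷ []) v
      halts a b refl = 0 , e-mu (subst (Eval distancePR (0 ∷ a ∷ b ∷ []))
                                       (cong₂ _+_ (ℕP.n∸n≡0 (f a)) (ℕP.n∸n≡0 (f a))) (eval-distance 0 a b))
                                (λ _ ())
      onGraph : ∀ a b → (∃ λ v → Eval (mu distancePR) (a ∷ b ∷ []) v) → b ≡ f a
      onGraph a b (v , e-mu atV _) =
        ℕP.≤-antisym (ℕP.m∸n≡0⇒m≤n (ℕP.m+n≡0⇒n≡0 (f a ∸ b) distance≡0))
                     (ℕP.m∸n≡0⇒m≤n (ℕP.m+n≡0⇒m≡0 (f a ∸ b) distance≡0))
        where
        distance≡0 : (f a ∸ b) + (b ∸ f a) ≡ 0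
        distance≡0 = sym (eval-deterministic atV (eval-distance v a b))

module StraightLine where
  open import Data.Nat as ℕ using (ℕ; zero; suc; _≤_; _<_; s≤s; z≤n; _+_; _*_)
  import Data.Nat.Properties as ℕP
  open import Data.Integer as ℤ using (ℤ; +_; ∣_∣)
  import Data.Integer.Properties as ℤP
  open import Data.List using (List; []; _∷_; _++_)
  open import Data.List.Relation.Unary.All using (All; []; _∷_)
  import Data.List.Relation.Unary.All.Properties as AllP
  open import Data.Product using (_,_; _×_)
  open import Data.Unit using (⊤; tt)
  open import Data.Empty using (⊥-elim)
  open import Data.Sum using (inj₁; inj₂)
  open import Relation.Binary.PropositionalEquality
  open import Relation.Nullary using (yes; no)
  open import Data.Integer.Tactic.RingSolver using (solve-∀)

  Assignment : Set
  Assignment = ℕ → ℤ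

  -- The equation x + x = x (used to pin down x₀ = 0) forces x = 0.
  idempotent⇒zero : ∀ (x : ℤ) → x ℤ.+ x ≡ x → x ≡ + 0
  idempotent⇒zero x eq = trans (sym (cancel x)) (trans (cong (ℤ._- x) eq) (ℤP.+-inverseʳ x))
    where cancel : ∀ x → x ℤ.+ x ℤ.- x ≡ x
          cancel = solve-∀

  -- A program of length k introduces x₀ … x_{k−1}
  -- in order; each new variable x_k is free or is determined by earlier ones
  -- through a single equation of E_n:
  --   isOne : x_k = 1              isZero : x_k + x_k = x_k
  --   sum i j : x_i + x_j = x_k     difference i j : x_k + x_j = x_i
  --   product i j : x_i · x_j = x_k

  data Step (k : ℕ) : Set where
    free isOne isZero : Step k
    sum difference product : (i j : ℕ) → i < k → j < k → Step k

  infixl 5 _▷_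
  data Program : ℕ → Set where
    []  : Program 0
    _▷_ : ∀ {k} → Program k → Step k → Program (suc k)

  StepHolds : ∀ {k} → Step k → Assignment → Set
  StepHolds free                   ρ = ⊤
  StepHolds {k} isOne              ρ = ρ k ≡ + 1
  StepHolds {k} isZero             ρ = ρ k ℤ.+ ρ k ≡ ρ k
  StepHolds {k} (sum i j _ _)        ρ = ρ i ℤ.+ ρ j ≡ ρ k
  StepHolds {k} (difference i j _ _) ρ = ρ k ℤ.+ ρ j ≡ ρ i
  StepHolds {k} (product i j _ _)    ρ = ρ i ℤ.* ρ j ≡ ρ k

  Satisfies : ∀ {k} → Program k → Assignment → Set
  Satisfies []       ρ = ⊤
  Satisfies (P ▷ s) ρ = Satisfies P ρ × StepHolds s ρ

  data Equation : Set where
    one′      : ℕ → Equation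
    add′ mul′ : ℕ → ℕ → ℕ → Equation

  EqHolds : Assignment → Equation → Set
  EqHolds ρ (one′ i)     = ρ i ≡ + 1
  EqHolds ρ (add′ i j k) = ρ i ℤ.+ ρ j ≡ ρ k
  EqHolds ρ (mul′ i j k) = ρ i ℤ.* ρ j ≡ ρ k

  stepEquations : ∀ {k} → Step k → List Equation
  stepEquations free                     = []
  stepEquations {k} isOne                = one′ k ∷ []
  stepEquations {k} isZero               = add′ k k k ∷ []
  stepEquations {k} (sum i j _ _)        = add′ i j k ∷ []
  stepEquations {k} (difference i j _ _) = add′ k j i ∷ []
  stepEquations {k} (product i j _ _)    = mul′ i j k ∷ []

  equations : ∀ {k} → Program k → List Equation
  equations []      = []
  equations (P ▷ s) = stepEquations s ++ equations P

  stepEquations⇒ : ∀ {k} (s : Step k) ρ → All (EqHolds ρ) (stepEquations s) → StepHolds s ρ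
  stepEquations⇒ free                 ρ _       = tt
  stepEquations⇒ isOne                ρ (e ∷ []) = e
  stepEquations⇒ isZero               ρ (e ∷ []) = e
  stepEquations⇒ (sum _ _ _ _)        ρ (e ∷ []) = e
  stepEquations⇒ (difference _ _ _ _) ρ (e ∷ []) = e
  stepEquations⇒ (product _ _ _ _)    ρ (e ∷ []) = e

  stepEquations⇐ : ∀ {k} (s : Step k) ρ → StepHolds s ρ → All (EqHolds ρ) (stepEquations s)
  stepEquations⇐ free                 ρ _ = []
  stepEquations⇐ isOne                ρ e = e ∷ []
  stepEquations⇐ isZero               ρ e = e ∷ []
  stepEquations⇐ (sum _ _ _ _)        ρ e = e ∷ []
  stepEquations⇐ (difference _ _ _ _) ρ e = e ∷ []
  stepEquations⇐ (product _ _ _ _)    ρ e = e ∷ []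

  equations⇒ : ∀ {k} (P : Program k) ρ → All (EqHolds ρ) (equations P) → Satisfies P ρ
  equations⇒ []      ρ _  = tt
  equations⇒ (P ▷ s) ρ es =
    equations⇒ P ρ (AllP.++⁻ʳ (stepEquations s) es) , stepEquations⇒ s ρ (AllP.++⁻ˡ (stepEquations s) es)

  equations⇐ : ∀ {k} (P : Program k) ρ → Satisfies P ρ → All (EqHolds ρ) (equations P)
  equations⇐ []      ρ _         = []
  equations⇐ (P ▷ s) ρ (sat , h) = AllP.++⁺ (stepEquations⇐ s ρ h) (equations⇐ P ρ sat)

  data _⊑_ : ∀ {k k′} → Program k → Program k′ → Set where
    ⊑-refl : ∀ {k} {P : Program k} → P ⊑ P
    ⊑-step : ∀ {k k′} {P : Program k} {Q : Program k′} {s} → P ⊑ Q → P ⊑ (Q ▷ s)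

  ⊑-trans : ∀ {k k′ k″} {P : Program k} {Q : Program k′} {R : Program k″} → P ⊑ Q → Q ⊑ R → P ⊑ R
  ⊑-trans p ⊑-refl     = p
  ⊑-trans p (⊑-step q) = ⊑-step (⊑-trans p q)

  ⊑-length : ∀ {k k′} {P : Program k} {Q : Program k′} → P ⊑ Q → k ≤ k′
  ⊑-length ⊑-refl     = ℕP.≤-refl
  ⊑-length (⊑-step p) = ℕP.m≤n⇒m≤1+n (⊑-length p)

  ⊑-satisfies : ∀ {k k′} {P : Program k} {Q : Program k′} → P ⊑ Q → ∀ ρ → Satisfies Q ρ → Satisfies P ρ
  ⊑-satisfies ⊑-refl     ρ sat       = sat
  ⊑-satisfies (⊑-step p) ρ (sat , _) = ⊑-satisfies p ρ sat

  Agree : ℕ → Assignment → Assignment → Set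
  Agree k ρ ρ′ = ∀ i → i < k → ρ i ≡ ρ′ i

  agree-weaken : ∀ {k} ρ ρ′ → Agree (suc k) ρ ρ′ → Agree k ρ ρ′
  agree-weaken ρ ρ′ ag i i<k = ag i (ℕP.m≤n⇒m≤1+n i<k)

  agree-suc : ∀ {k ρ ρ′} → Agree k ρ ρ′ → ρ k ≡ ρ′ k → Agree (suc k) ρ ρ′
  agree-suc ag here i i<1+k with ℕP.m≤n⇒m<n∨m≡n (ℕ.s≤s⁻¹ i<1+k)
  ... | inj₁ i<k  = ag i i<k
  ... | inj₂ refl = here

  agree-trans : ∀ {k k′ ρ ρ′ ρ″} → k ≤ k′ → Agree k′ ρ ρ′ → Agree k ρ′ ρ″ → Agree k ρ ρ″
  agree-trans k≤k′ ag ag′ i i<k = trans (ag i (ℕP.<-≤-trans i<k k≤k′)) (ag′ i i<k)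

  stepHolds-local : ∀ {k} (s : Step k) ρ ρ′ → Agree (suc k) ρ ρ′ → StepHolds s ρ → StepHolds s ρ′
  stepHolds-local free ρ ρ′ ag _ = tt
  stepHolds-local {k} isOne ρ ρ′ ag h = trans (sym (ag k ℕP.≤-refl)) h
  stepHolds-local {k} isZero ρ ρ′ ag h = subst (λ t → t ℤ.+ t ≡ t) (ag k ℕP.≤-refl) h
  stepHolds-local {k} (sum i j i<k j<k) ρ ρ′ ag h =
    subst₂ (λ u v → u ℤ.+ v ≡ ρ′ k) (ag i (ℕP.m≤n⇒m≤1+n i<k)) (ag j (ℕP.m≤n⇒m≤1+n j<k)) (trans h (ag k ℕP.≤-refl))
  stepHolds-local {k} (difference i j i<k j<k) ρ ρ′ ag h =
    subst₂ (λ u v → u ℤ.+ v ≡ ρ′ i) (ag k ℕP.≤-refl) (ag j (ℕP.m≤n⇒m≤1+n j<k)) (trans h (ag i (ℕP.m≤n⇒m≤1+n i<k)))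
  stepHolds-local {k} (product i j i<k j<k) ρ ρ′ ag h =
    subst₂ (λ u v → u ℤ.* v ≡ ρ′ k) (ag i (ℕP.m≤n⇒m≤1+n i<k)) (ag j (ℕP.m≤n⇒m≤1+n j<k)) (trans h (ag k ℕP.≤-refl))

  satisfies-local : ∀ {k} (P : Program k) ρ ρ′ → Agree k ρ ρ′ → Satisfies P ρ → Satisfies P ρ′
  satisfies-local []      ρ ρ′ ag _         = tt
  satisfies-local (P ▷ s) ρ ρ′ ag (sat , h) =
    satisfies-local P ρ ρ′ (agree-weaken ρ ρ′ ag) sat , stepHolds-local s ρ ρ′ ag h

  IndicesBelow : ℕ → Equation → Set
  IndicesBelow n (one′ i)     = i < n
  IndicesBelow n (add′ i j k) = i < n × j < n × k < n
  IndicesBelow n (mul′ i j k) = i < n × j < n × k < n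

  eqHolds-local : ∀ {n} e ρ ρ′ → IndicesBelow n e → Agree n ρ ρ′ → EqHolds ρ e → EqHolds ρ′ e
  eqHolds-local (one′ i) ρ ρ′ i<n ag h = trans (sym (ag i i<n)) h
  eqHolds-local (add′ i j k) ρ ρ′ (i<n , j<n , k<n) ag h =
    trans (cong₂ ℤ._+_ (sym (ag i i<n)) (sym (ag j j<n))) (trans h (ag k k<n))
  eqHolds-local (mul′ i j k) ρ ρ′ (i<n , j<n , k<n) ag h =
    trans (cong₂ ℤ._*_ (sym (ag i i<n)) (sym (ag j j<n))) (trans h (ag k k<n))

  equationsHold-local : ∀ {n} es ρ ρ′ → All (IndicesBelow n) es → Agree n ρ ρ′ →
                        All (EqHolds ρ) es → All (EqHolds ρ′) es
  equationsHold-local []       ρ ρ′ []         ag []       = []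
  equationsHold-local (e ∷ es) ρ ρ′ (ib ∷ ibs) ag (h ∷ hs) =
    eqHolds-local e ρ ρ′ ib ag h ∷ equationsHold-local es ρ ρ′ ibs ag hs

  stepValue : ∀ {k} → Step k → Assignment → ℤ → ℤ
  stepValue free                     ρ c = c
  stepValue isOne                    ρ c = + 1
  stepValue isZero                   ρ c = + 0
  stepValue (sum i j _ _)            ρ c = ρ i ℤ.+ ρ j
  stepValue (difference i j _ _)     ρ c = ρ i ℤ.- ρ j
  stepValue (product i j _ _)        ρ c = ρ i ℤ.* ρ j

  update : ℕ → ℤ → Assignment → Assignment
  update k v ρ i with i ℕ.≟ k
  ... | yes _ = v
  ... | no _  = ρ i

  update-here : ∀ k v ρ → update k v ρ k ≡ v
  update-here k v ρ with k ℕ.≟ k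
  ... | yes _  = refl
  ... | no k≢k = ⊥-elim (k≢k refl)

  update-there : ∀ k v ρ i → i < k → update k v ρ i ≡ ρ i
  update-there k v ρ i i<k with i ℕ.≟ k
  ... | yes refl = ⊥-elim (ℕP.<-irrefl refl i<k)
  ... | no _     = refl

  -- The run is kept abstract: its unfolding duplicates the earlier run at
  -- every step, and all that is needed of it are the two laws below.
  abstract
    run : ∀ {k} → Program k → Assignment → Assignment
    run []                 φ = φ
    run (_▷_ {k} P s) φ = update k (stepValue s (run P φ) (φ k)) (run P φ)

    run-new : ∀ {k} (P : Program k) s φ → run (P ▷ s) φ k ≡ stepValue s (run P φ) (φ k)
    run-new {k} P s φ = update-here k _ (run P φ)

    run-old : ∀ {k} (P : Program k) s φ i → i < k → run (P ▷ s) φ i ≡ run P φ i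
    run-old {k} P s φ i i<k = update-there k _ (run P φ) i i<k

  ⊑-run : ∀ {k k′} {P : Program k} {Q : Program k′} → P ⊑ Q → ∀ φ → Agree k (run Q φ) (run P φ)
  ⊑-run ⊑-refl φ i i<k = refl
  ⊑-run {Q = Q ▷ s} (⊑-step p) φ i i<k =
    trans (run-old Q s φ i (ℕP.<-≤-trans i<k (⊑-length p))) (⊑-run p φ i i<k)

  run-free : ∀ {j k} {P : Program j} {Q : Program k} → (P ▷ free) ⊑ Q → ∀ φ → run Q φ j ≡ φ j
  run-free {j} {P = P} P⊑Q φ = trans (⊑-run P⊑Q φ j (ℕP.n<1+n j)) (run-new P free φ)

  run-satisfies : ∀ {k} (P : Program k) φ → Satisfies P (run P φ)
  run-satisfies []               φ = tt
  run-satisfies {suc k} (P ▷ s) φ =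
    satisfies-local P (run P φ) (run (P ▷ s) φ) (λ i i<k → sym (run-old P s φ i i<k)) (run-satisfies P φ) ,
    lastStep s
    where
    minusPlus : ∀ a b → a ℤ.- b ℤ.+ b ≡ a
    minusPlus = solve-∀
    lastStep : ∀ s → StepHolds s (run (P ▷ s) φ)
    lastStep free = tt
    lastStep isOne = run-new P isOne φ
    lastStep isZero = trans (cong (λ t → t ℤ.+ t) (run-new P isZero φ)) (sym (run-new P isZero φ))
    lastStep s@(sum i j i<k j<k) =
      trans (cong₂ ℤ._+_ (run-old P s φ i i<k) (run-old P s φ j j<k)) (sym (run-new P s φ))
    lastStep s@(difference i j i<k j<k) =
      trans (cong₂ ℤ._+_ (run-new P s φ) (run-old P s φ j j<k))
            (trans (minusPlus (run P φ i) (run P φ j)) (sym (run-old P s φ i i<k)))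
    lastStep s@(product i j i<k j<k) =
      trans (cong₂ ℤ._*_ (run-old P s φ i i<k) (run-old P s φ j j<k)) (sym (run-new P s φ))

  run-local : ∀ {k} (P : Program k) φ ψ → Agree k φ ψ → Agree k (run P φ) (run P ψ)
  run-local [] φ ψ ag i ()
  run-local {suc k} (P ▷ s) φ ψ ag =
    agree-suc (λ i i<k → trans (run-old P s φ i i<k) (trans (ih i i<k) (sym (run-old P s ψ i i<k))))
              (trans (run-new P s φ) (trans (stepValue-local s (ag k ℕP.≤-refl)) (sym (run-new P s ψ))))
    where
    ih : Agree k (run P φ) (run P ψ)
    ih = run-local P φ ψ (agree-weaken φ ψ ag)
    stepValue-local : ∀ s {c c′} → c ≡ c′ → stepValue s (run P φ) c ≡ stepValue s (run P ψ) c′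
    stepValue-local free                       refl = refl
    stepValue-local isOne                      refl = refl
    stepValue-local isZero                     refl = refl
    stepValue-local (sum i j i<k j<k)          refl = cong₂ ℤ._+_ (ih i i<k) (ih j j<k)
    stepValue-local (difference i j i<k j<k)   refl = cong₂ ℤ._-_ (ih i i<k) (ih j j<k)
    stepValue-local (product i j i<k j<k)      refl = cong₂ ℤ._*_ (ih i i<k) (ih j j<k)

  -- A satisfying assignment is reproduced by running the program on itself:
  -- the non-free variables are determined by the earlier ones.
  run-determined : ∀ {k} (P : Program k) ρ → Satisfies P ρ → Agree k (run P ρ) ρ
  run-determined [] ρ _ i ()
  run-determined {suc k} (P ▷ s) ρ (sat , h) =
    agree-suc (λ i i<k → trans (run-old P s ρ i i<k) (ih i i<k)) (trans (run-new P s ρ) (lastValue s h))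
    where
    ih : Agree k (run P ρ) ρ
    ih = run-determined P ρ sat
    plusMinus : ∀ a b → a ℤ.+ b ℤ.- b ≡ a
    plusMinus = solve-∀
    lastValue : ∀ s → StepHolds s ρ → stepValue s (run P ρ) (ρ k) ≡ ρ k
    lastValue free                     _ = refl
    lastValue isOne                    e = sym e
    lastValue isZero                   e = sym (idempotent⇒zero (ρ k) e)
    lastValue (sum i j i<k j<k)        e = trans (cong₂ ℤ._+_ (ih i i<k) (ih j j<k)) e
    lastValue (difference i j i<k j<k) e =
      trans (cong₂ ℤ._-_ (ih i i<k) (ih j j<k)) (trans (cong (ℤ._- ρ j) (sym e)) (plusMinus (ρ k) (ρ j)))
    lastValue (product i j i<k j<k)    e = trans (cong₂ ℤ._*_ (ih i i<k) (ih j j<k)) e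

  extend : ∀ {k k′} {P : Program k} {Q : Program k′} → P ⊑ Q → ∀ ρ φ →
           Satisfies P ρ → Agree k φ ρ → Satisfies Q (run Q φ) × Agree k (run Q φ) ρ
  extend {P = P} {Q} P⊑Q ρ φ sat ag =
    run-satisfies Q φ ,
    λ i i<k → trans (⊑-run P⊑Q φ i i<k) (trans (run-local P φ ρ ag i i<k) (run-determined P ρ sat i i<k))

  FreeBounded : ∀ {k} → Program k → Assignment → ℕ → Set
  FreeBounded []            ρ R = ⊤
  FreeBounded (_▷_ {k} P s) ρ R = FreeBounded P ρ R × (s ≡ free → ∣ ρ k ∣ ≤ R)

  growth : ℕ → ℕ → ℕ
  growth R zero    = suc R
  growth R (suc k) = growth R k * growth R k + growth R k

  growth-step : ∀ R k → growth R k ≤ growth R (suc k)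
  growth-step R k = ℕP.m≤n+m (growth R k) (growth R k * growth R k)

  growth-base : ∀ R k → suc R ≤ growth R k
  growth-base R zero    = ℕP.≤-refl
  growth-base R (suc k) = ℕP.≤-trans (growth-base R k) (growth-step R k)

  growth-sq : ∀ R k → growth R k ≤ growth R k * growth R k
  growth-sq R k = ℕP.m≤m*n (growth R k) (growth R k) {{ℕ.>-nonZero (ℕP.<-≤-trans (s≤s z≤n) (growth-base R k))}}

  stepBound : ∀ {k} (s : Step k) ρ R C → R < C → (∀ i → i < k → ∣ ρ i ∣ ≤ C) → C ≤ C * C →
              StepHolds s ρ → (s ≡ free → ∣ ρ k ∣ ≤ R) → ∣ ρ k ∣ ≤ C * C + C
  stepBound {k} free ρ R C R<C old C≤C² _ isFree =
    ℕP.≤-trans (isFree refl) (ℕP.≤-trans (ℕP.<⇒≤ R<C) (ℕP.m≤n+m C (C * C)))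
  stepBound {k} isOne ρ R C R<C old C≤C² e _ =
    ℕP.≤-trans (ℕP.≤-reflexive (cong ∣_∣ e)) (ℕP.≤-trans (ℕP.<-≤-trans (s≤s z≤n) R<C) (ℕP.m≤n+m C (C * C)))
  stepBound {k} isZero ρ R C R<C old C≤C² e _ =
    ℕP.≤-trans (ℕP.≤-reflexive (cong ∣_∣ (idempotent⇒zero (ρ k) e))) z≤n
  stepBound {k} (sum i j i<k j<k) ρ R C R<C old C≤C² e _ =
    subst (λ t → ∣ t ∣ ≤ C * C + C) e
      (ℕP.≤-trans (ℤP.∣i+j∣≤∣i∣+∣j∣ (ρ i) (ρ j)) (ℕP.+-mono-≤ (ℕP.≤-trans (old i i<k) C≤C²) (old j j<k)))
  stepBound {k} (difference i j i<k j<k) ρ R C R<C old C≤C² e _ =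
    subst (λ t → ∣ t ∣ ≤ C * C + C) (trans (cong (ℤ._- ρ j) (sym e)) (plusMinus (ρ k) (ρ j)))
      (ℕP.≤-trans (ℤP.∣i-j∣≤∣i∣+∣j∣ (ρ i) (ρ j)) (ℕP.+-mono-≤ (ℕP.≤-trans (old i i<k) C≤C²) (old j j<k)))
    where plusMinus : ∀ a b → a ℤ.+ b ℤ.- b ≡ a
          plusMinus = solve-∀
  stepBound {k} (product i j i<k j<k) ρ R C R<C old C≤C² e _ =
    subst (λ t → ∣ t ∣ ≤ C * C + C) e
      (ℕP.≤-trans (ℕP.≤-reflexive (ℤP.abs-* (ρ i) (ρ j)))
        (ℕP.≤-trans (ℕP.*-mono-≤ (old i i<k) (old j j<k)) (ℕP.m≤m+n (C * C) C)))

  bounded : ∀ {k} (P : Program k) ρ R → Satisfies P ρ → FreeBounded P ρ R → ∀ i → i < k → ∣ ρ i ∣ ≤ growth R k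
  bounded {suc k} (P ▷ s) ρ R (sat , h) (fb , isFree) i i<1+k with i ℕ.≟ k
  ... | no i≢k   = ℕP.≤-trans (bounded P ρ R sat fb i (ℕP.≤∧≢⇒< (ℕ.s≤s⁻¹ i<1+k) i≢k)) (growth-step R k)
  ... | yes refl = stepBound s ρ R (growth R k) (growth-base R k) (bounded P ρ R sat fb) (growth-sq R k) h isFree

module Gadgets where
  open FourSquares using (sumSq; sumSq-pos; sumSqℤ-abs; lagrange; module IntegerIdentities)
  open IntegerIdentities using (sumSqℤ; sumSqℤ-cong)
  open StraightLine
  open import Data.Nat as ℕ using (ℕ; zero; suc; _≤_; _<_; z≤n; _+_; _*_; _∸_; _<?_)
  import Data.Nat.Properties as ℕP
  open import Data.Integer as ℤ using (ℤ; +_; ∣_∣)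
  open import Data.Product using (Σ; _,_; _×_; proj₁)
  open import Data.Sum using (inj₁; inj₂)
  open import Data.Empty using (⊥-elim)
  open import Relation.Binary.PropositionalEquality
  open import Relation.Nullary using (yes; no)
  open import Relation.Nullary.Decidable using (True; toWitness)

  shifted< : ∀ a j k → {True (a <? j)} → a + k < j + k
  shifted< a j k {a<j} = ℕP.+-monoˡ-< k (toWitness a<j)

  -- The four-square gadget: starting at position k, four free roots
  -- r₀…r₃ (positions k … k+3), their squares, and the running sums; the
  -- value  r₀² + r₁² + r₂² + r₃²  sits at position k+10.  By Lagrange's
  -- theorem its possible values are exactly the natural numbers, and each
  -- value has only finitely many roots.

  fourRoots : ∀ {k} → Program k → Program (4 + k)
  fourRoots P = P ▷ free ▷ free ▷ free ▷ free

  squareSumGadget : ∀ {k} → Program k → Program (11 + k)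
  squareSumGadget {k} P = fourRoots P
    ▷ product k k (shifted< 0 4 k) (shifted< 0 4 k)
    ▷ product (1 + k) (1 + k) (shifted< 1 5 k) (shifted< 1 5 k)
    ▷ product (2 + k) (2 + k) (shifted< 2 6 k) (shifted< 2 6 k)
    ▷ product (3 + k) (3 + k) (shifted< 3 7 k) (shifted< 3 7 k)
    ▷ sum (4 + k) (5 + k) (shifted< 4 8 k) (shifted< 5 8 k)
    ▷ sum (8 + k) (6 + k) (shifted< 8 9 k) (shifted< 6 9 k)
    ▷ sum (9 + k) (7 + k) (shifted< 9 10 k) (shifted< 7 10 k)

  fourRoots-⊑ : ∀ {k} (P : Program k) → fourRoots P ⊑ squareSumGadget P
  fourRoots-⊑ P = ⊑-step (⊑-step (⊑-step (⊑-step (⊑-step (⊑-step (⊑-step ⊑-refl))))))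

  gadget-⊑ : ∀ {k} (P : Program k) → P ⊑ squareSumGadget P
  gadget-⊑ P = ⊑-trans (⊑-step (⊑-step (⊑-step (⊑-step ⊑-refl)))) (fourRoots-⊑ P)

  gadget-value : ∀ {k} (P : Program k) ρ → Satisfies (squareSumGadget P) ρ →
    ρ (10 + k) ≡ sumSqℤ (ρ k) (ρ (1 + k)) (ρ (2 + k)) (ρ (3 + k))
  gadget-value P ρ (((((((_ , sq₀) , sq₁) , sq₂) , sq₃) , s₀₁) , s₀₁₂) , s₀₁₂₃) =
    trans (sym s₀₁₂₃) (cong₂ ℤ._+_ (trans (sym s₀₁₂) (cong₂ ℤ._+_ (trans (sym s₀₁) (cong₂ ℤ._+_ (sym sq₀) (sym sq₁)))
                                                                (sym sq₂)))
                                   (sym sq₃))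

  root≤sumSq : ∀ a b c d → a ≤ sumSq a b c d × b ≤ sumSq a b c d × c ≤ sumSq a b c d × d ≤ sumSq a b c d
  root≤sumSq a b c d =
    ℕP.≤-trans (n≤n² a) (ℕP.≤-trans (ℕP.m≤m+n _ _) (ℕP.≤-trans (ℕP.m≤m+n _ _) (ℕP.m≤m+n _ _))) ,
    ℕP.≤-trans (n≤n² b) (ℕP.≤-trans (ℕP.m≤n+m _ (a * a)) (ℕP.≤-trans (ℕP.m≤m+n _ _) (ℕP.m≤m+n _ _))) ,
    ℕP.≤-trans (n≤n² c) (ℕP.≤-trans (ℕP.m≤n+m _ (a * a + b * b)) (ℕP.m≤m+n _ (d * d))) ,
    ℕP.≤-trans (n≤n² d) (ℕP.m≤n+m _ _)
    where
    n≤n² : ∀ n → n ≤ n * n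
    n≤n² zero    = z≤n
    n≤n² (suc n) = ℕP.m≤m*n (suc n) (suc n)

  RootsBounded : Assignment → ℕ → ℕ → Set
  RootsBounded ρ p R = ∣ ρ p ∣ ≤ R × ∣ ρ (1 + p) ∣ ≤ R × ∣ ρ (2 + p) ∣ ≤ R × ∣ ρ (3 + p) ∣ ≤ R

  RootsBounded-mono : ∀ ρ p {R R′} → R ≤ R′ → RootsBounded ρ p R → RootsBounded ρ p R′
  RootsBounded-mono ρ p R≤R′ (b₀ , b₁ , b₂ , b₃) =
    ℕP.≤-trans b₀ R≤R′ , ℕP.≤-trans b₁ R≤R′ , ℕP.≤-trans b₂ R≤R′ , ℕP.≤-trans b₃ R≤R′

  rootNorm : Assignment → ℕ → ℕ
  rootNorm ρ p = sumSq (∣ ρ p ∣) (∣ ρ (1 + p) ∣) (∣ ρ (2 + p) ∣) (∣ ρ (3 + p) ∣)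

  rootNorm-bounds : ∀ ρ p → RootsBounded ρ p (rootNorm ρ p)
  rootNorm-bounds ρ p = root≤sumSq (∣ ρ p ∣) (∣ ρ (1 + p) ∣) (∣ ρ (2 + p) ∣) (∣ ρ (3 + p) ∣)

  gadget-natural : ∀ {k} (P : Program k) ρ → Satisfies (squareSumGadget P) ρ → ρ (10 + k) ≡ + rootNorm ρ k
  gadget-natural {k} P ρ sat = trans (gadget-value P ρ sat) (sumSqℤ-abs (ρ k) (ρ (1 + k)) (ρ (2 + k)) (ρ (3 + k)))

  gadget-freeBounded : ∀ {k} (P : Program k) ρ R → FreeBounded P ρ R → RootsBounded ρ k R →
                       FreeBounded (squareSumGadget P) ρ R
  gadget-freeBounded P ρ R fb (b₀ , b₁ , b₂ , b₃) =
    ((((((((((fb , λ _ → b₀) , λ _ → b₁) , λ _ → b₂) , λ _ → b₃)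
      , λ ()) , λ ()) , λ ()) , λ ()) , λ ()) , λ ()) , λ ()

  module GadgetExtension {k} (P : Program k) (ρ : Assignment) (sat : Satisfies P ρ) (r₀ r₁ r₂ r₃ : ℤ) where
    roots : ℕ → ℤ
    roots 0 = r₀
    roots 1 = r₁
    roots 2 = r₂
    roots _ = r₃

    φ : Assignment
    φ i with i <? k
    ... | yes _ = ρ i
    ... | no _  = roots (i ∸ k)

    φ-old : Agree k φ ρ
    φ-old i i<k with i <? k
    ... | yes _   = refl
    ... | no i≮k = ⊥-elim (i≮k i<k)

    φ-root : ∀ t → φ (t + k) ≡ roots t
    φ-root t with t + k <? k
    ... | yes t+k<k = ⊥-elim (ℕP.<-irrefl refl (ℕP.≤-<-trans (ℕP.m≤n+m k t) t+k<k))
    ... | no _      = cong roots (ℕP.m+n∸n≡m t k)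

    ρ′ : Assignment
    ρ′ = run (squareSumGadget P) φ

    extension : Satisfies (squareSumGadget P) ρ′ × Agree k ρ′ ρ
    extension = extend (gadget-⊑ P) ρ φ sat φ-old

    root : ∀ t → (P′ : Program (t + k)) → (P′ ▷ free) ⊑ squareSumGadget P → ρ′ (t + k) ≡ roots t
    root t P′ prefix = trans (run-free prefix φ) (φ-root t)

    value : ρ′ (10 + k) ≡ sumSqℤ r₀ r₁ r₂ r₃
    value = trans (gadget-value P ρ′ (proj₁ extension))
      (sumSqℤ-cong (root 0 P (⊑-trans (⊑-step (⊑-step (⊑-step ⊑-refl))) (fourRoots-⊑ P)))
                   (root 1 (P ▷ free) (⊑-trans (⊑-step (⊑-step ⊑-refl)) (fourRoots-⊑ P)))
                   (root 2 (P ▷ free ▷ free) (⊑-trans (⊑-step ⊑-refl) (fourRoots-⊑ P)))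
                   (root 3 (P ▷ free ▷ free ▷ free) (fourRoots-⊑ P)))

  Extends : ∀ {k k′} → Program k → Program k′ → Assignment → Set
  Extends {k} P P′ ρ = Σ Assignment λ ρ′ → Satisfies P′ ρ′ × Agree k ρ′ ρ

  extendWithValue : ∀ {k} (P : Program k) ρ → Satisfies P ρ → (q : ℕ) →
    Σ (Extends P (squareSumGadget P) ρ) λ ext → proj₁ ext (10 + k) ≡ + q
  extendWithValue P ρ sat q with lagrange q
  ... | a , b , c , d , q≡ =
    (ρ′ , extension) , trans value (sym (trans (cong +_ q≡) (sumSq-pos a b c d)))
    where open GadgetExtension P ρ sat (+ a) (+ b) (+ c) (+ d)

  gadgetStart : ℕ → ℕ → ℕ
  gadgetStart k zero    = k
  gadgetStart k (suc j) = 11 + gadgetStart k j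

  valuePos : ℕ → ℕ → ℕ
  valuePos k j = 10 + gadgetStart k j

  gadgets : ∀ {k} → Program k → (m : ℕ) → Program (gadgetStart k m)
  gadgets P zero    = P
  gadgets P (suc j) = squareSumGadget (gadgets P j)

  gadgets-⊑ : ∀ {k} (P : Program k) {j m} → j ≤ m → gadgets P j ⊑ gadgets P m
  gadgets-⊑ P {m = zero} z≤n = ⊑-refl
  gadgets-⊑ P {j} {suc m} j≤1+m with ℕP.m≤n⇒m<n∨m≡n j≤1+m
  ... | inj₁ j<1+m = ⊑-trans (gadgets-⊑ P (ℕ.s≤s⁻¹ j<1+m)) (gadget-⊑ (gadgets P m))
  ... | inj₂ refl  = ⊑-refl

  gadgetStart-mono : ∀ {k} (P : Program k) {j m} → j ≤ m → gadgetStart k j ≤ gadgetStart k m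
  gadgetStart-mono P j≤m = ⊑-length (gadgets-⊑ P j≤m)

  valuePos< : ∀ {k} (P : Program k) {j m} → j < m → valuePos k j < gadgetStart k m
  valuePos< {k} P {j} j<m =
    ℕP.<-≤-trans (ℕP.+-monoˡ-< (gadgetStart k j) (toWitness {a? = 10 <? 11} _)) (gadgetStart-mono P j<m)

  gadgets-natural : ∀ {k} (P : Program k) m ρ → Satisfies (gadgets P m) ρ → ∀ j → j < m →
    ρ (valuePos k j) ≡ + rootNorm ρ (gadgetStart k j)
  gadgets-natural P m ρ sat j j<m = gadget-natural (gadgets P j) ρ (⊑-satisfies (gadgets-⊑ P j<m) ρ sat)

  gadgets-freeBounded : ∀ {k} (P : Program k) m ρ R → FreeBounded P ρ R →
    (∀ j → j < m → RootsBounded ρ (gadgetStart k j) R) → FreeBounded (gadgets P m) ρ R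
  gadgets-freeBounded P zero    ρ R fb roots = fb
  gadgets-freeBounded P (suc m) ρ R fb roots =
    gadget-freeBounded (gadgets P m) ρ R
      (gadgets-freeBounded P m ρ R fb (λ j j<m → roots j (ℕP.m≤n⇒m≤1+n j<m))) (roots m ℕP.≤-refl)

  extendWithValues : ∀ {k} (P : Program k) (values : ℕ → ℕ) m ρ → Satisfies P ρ →
    Σ (Extends P (gadgets P m) ρ) λ ext → ∀ j → j < m → proj₁ ext (valuePos k j) ≡ + values j
  extendWithValues P values zero ρ sat = (ρ , sat , λ _ _ → refl) , λ _ ()
  extendWithValues {k} P values (suc m) ρ sat
    with extendWithValues P values m ρ sat
  ... | (ρ₁ , sat₁ , ag₁) , values₁
    with extendWithValue (gadgets P m) ρ₁ sat₁ (values m)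
  ... | (ρ₂ , sat₂ , ag₂) , value₂ =
    (ρ₂ , sat₂ , λ i i<k → trans (ag₂ i (ℕP.<-≤-trans i<k (gadgetStart-mono P {0} {m} z≤n))) (ag₁ i i<k)) , values₂
    where
    values₂ : ∀ j → j < suc m → ρ₂ (valuePos k j) ≡ + values j
    values₂ j j<1+m with ℕP.m≤n⇒m<n∨m≡n (ℕ.s≤s⁻¹ j<1+m)
    ... | inj₁ j<m  = trans (ag₂ (valuePos k j) (valuePos< P j<m)) (values₁ j j<m)
    ... | inj₂ refl = value₂

module Compile where
  open StraightLine
  open import Data.Nat as ℕ using (ℕ; zero; suc; _≤_; _<_; s≤s; z≤n; _+_)
  import Data.Nat.Properties as ℕP
  open import Data.Integer as ℤ using (ℤ; +_; -[1+_])
  import Data.Integer.Properties as ℤP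
  open import Data.Fin using (Fin)
  open import Data.Vec using (Vec; lookup)
  open import Data.Sum using (inj₁; inj₂)
  open import Data.Product using (_,_)
  open import Relation.Binary.PropositionalEquality
  open import Data.Integer.Tactic.RingSolver using (solve-∀)

  -- Throughout, the program starts with x₀ = 0 and x₁ = 1, so 2 ≤ k.

  0<k : ∀ {k} → 2 ≤ k → 0 < k
  0<k 2≤k = ℕP.<-trans (s≤s z≤n) 2≤k

  record Compiled {k} (P : Program k) : Set where
    constructor compiled
    field
      size    : ℕ
      program : Program size
      prefix  : P ⊑ program
      output  : ℕ
      output< : output < size
  open Compiled public

  appendStep : ∀ {k k′} {P : Program k} {Q : Program k′} → P ⊑ Q → Step k′ → Compiled P
  appendStep {k′ = k′} {Q = Q} P⊑Q s = compiled (suc k′) (Q ▷ s) (⊑-step P⊑Q) k′ (ℕP.n<1+n k′)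

  constant : ∀ {k} (P : Program k) → 2 ≤ k → ℕ → Compiled P
  constant P 2≤k zero    = compiled _ P ⊑-refl 0 (0<k 2≤k)
  constant P 2≤k (suc n) = appendStep (prefix c) (sum (output c) 1 (output< c) (ℕP.<-≤-trans 2≤k (⊑-length (prefix c))))
    where
    c : Compiled P
    c = constant P 2≤k n

  constant-value : ∀ {k} (P : Program k) 2≤k n ρ → Satisfies (program (constant P 2≤k n)) ρ →
                   ρ 0 ≡ + 0 → ρ 1 ≡ + 1 → ρ (output (constant P 2≤k n)) ≡ + n
  constant-value P 2≤k zero    ρ sat x₀≡0 x₁≡1 = x₀≡0
  constant-value P 2≤k (suc n) ρ (sat , step) x₀≡0 x₁≡1 =
    trans (sym step) (trans (cong₂ ℤ._+_ (constant-value P 2≤k n ρ sat x₀≡0 x₁≡1) x₁≡1)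
                            (trans (sym (ℤP.pos-+ n 1)) (cong +_ (ℕP.+-comm n 1))))

  constant-freeBounded : ∀ {k} (P : Program k) 2≤k n ρ R → FreeBounded P ρ R →
                         FreeBounded (program (constant P 2≤k n)) ρ R
  constant-freeBounded P 2≤k zero    ρ R fb = fb
  constant-freeBounded P 2≤k (suc n) ρ R fb = constant-freeBounded P 2≤k n ρ R fb , λ ()

  mutual
    compile : ∀ {N k} (P : Program k) → 2 ≤ k → (env : Fin N → ℕ) → (∀ v → env v < k) → Poly N → Compiled P
    compile P 2≤k env env< (var v) = compiled _ P ⊑-refl (env v) (env< v)
    compile P 2≤k env env< (con (+ n)) = constant P 2≤k n
    compile P 2≤k env env< (con -[1+ n ]) =
      appendStep (prefix c) (difference 0 (output c) (ℕP.<-≤-trans (0<k 2≤k) (⊑-length (prefix c))) (output< c))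
      where
      c : Compiled P
      c = constant P 2≤k (suc n)
    compile P 2≤k env env< (p ⊕ q) =
      appendStep (⊑-trans (prefix c₁) (prefix c₂))
                 (sum (output c₁) (output c₂) (ℕP.<-≤-trans (output< c₁) (⊑-length (prefix c₂))) (output< c₂))
      where
      c₁ : Compiled P
      c₁ = compile P 2≤k env env< p
      c₂ : Compiled (program c₁)
      c₂ = compileAfter 2≤k env env< c₁ q
    compile P 2≤k env env< (p ⊗ q) =
      appendStep (⊑-trans (prefix c₁) (prefix c₂))
                 (product (output c₁) (output c₂) (ℕP.<-≤-trans (output< c₁) (⊑-length (prefix c₂))) (output< c₂))
      where
      c₁ : Compiled P
      c₁ = compile P 2≤k env env< p
      c₂ : Compiled (program c₁)
      c₂ = compileAfter 2≤k env env< c₁ q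

    compileAfter : ∀ {N k} {P : Program k} → 2 ≤ k → (env : Fin N → ℕ) → (∀ v → env v < k) →
                   (c : Compiled P) → Poly N → Compiled (program c)
    compileAfter {k = k} 2≤k env env< c q =
      compile (program c) (ℕP.≤-trans 2≤k grow) env (λ v → ℕP.<-≤-trans (env< v) grow) q
      where
      grow : k ≤ size c
      grow = ⊑-length (prefix c)

  compile-value : ∀ {N k} (P : Program k) 2≤k (env : Fin N → ℕ) env< p ρ →
    Satisfies (program (compile P 2≤k env env< p)) ρ → ρ 0 ≡ + 0 → ρ 1 ≡ + 1 →
    (E : Vec ℤ N) → (∀ v → lookup E v ≡ ρ (env v)) → ρ (output (compile P 2≤k env env< p)) ≡ evalP p E
  compile-value P 2≤k env env< (var v) ρ sat x₀ x₁ E E≡ = sym (E≡ v)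
  compile-value P 2≤k env env< (con (+ n)) ρ sat x₀ x₁ E E≡ = constant-value P 2≤k n ρ sat x₀ x₁
  compile-value P 2≤k env env< (con -[1+ n ]) ρ (sat , step) x₀ x₁ E E≡ =
    trans (sym (plusMinus (ρ (size c)) (ρ (output c))))
          (trans (cong (ℤ._- ρ (output c)) step) (cong₂ ℤ._-_ x₀ (constant-value P 2≤k (suc n) ρ sat x₀ x₁)))
    where
    c : Compiled P
    c = constant P 2≤k (suc n)
    plusMinus : ∀ a b → a ℤ.+ b ℤ.- b ≡ a
    plusMinus = solve-∀
  compile-value P 2≤k env env< (p ⊕ q) ρ (sat , step) x₀ x₁ E E≡ =
    trans (sym step) (cong₂ ℤ._+_ (compile-value P 2≤k env env< p ρ (⊑-satisfies (prefix c₂) ρ sat) x₀ x₁ E E≡)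
                                  (compile-value (program c₁) _ env _ q ρ sat x₀ x₁ E E≡))
    where
    c₁ : Compiled P
    c₁ = compile P 2≤k env env< p
    c₂ : Compiled (program c₁)
    c₂ = compileAfter 2≤k env env< c₁ q
  compile-value P 2≤k env env< (p ⊗ q) ρ (sat , step) x₀ x₁ E E≡ =
    trans (sym step) (cong₂ ℤ._*_ (compile-value P 2≤k env env< p ρ (⊑-satisfies (prefix c₂) ρ sat) x₀ x₁ E E≡)
                                  (compile-value (program c₁) _ env _ q ρ sat x₀ x₁ E E≡))
    where
    c₁ : Compiled P
    c₁ = compile P 2≤k env env< p
    c₂ : Compiled (program c₁)
    c₂ = compileAfter 2≤k env env< c₁ q

  compile-freeBounded : ∀ {N k} (P : Program k) 2≤k (env : Fin N → ℕ) env< p ρ R → FreeBounded P ρ R →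
                        FreeBounded (program (compile P 2≤k env env< p)) ρ R
  compile-freeBounded P 2≤k env env< (var v) ρ R fb = fb
  compile-freeBounded P 2≤k env env< (con (+ n)) ρ R fb = constant-freeBounded P 2≤k n ρ R fb
  compile-freeBounded P 2≤k env env< (con -[1+ n ]) ρ R fb = constant-freeBounded P 2≤k (suc n) ρ R fb , λ ()
  compile-freeBounded P 2≤k env env< (p ⊕ q) ρ R fb =
    compile-freeBounded _ _ env _ q ρ R (compile-freeBounded P 2≤k env env< p ρ R fb) , λ ()
  compile-freeBounded P 2≤k env env< (p ⊗ q) ρ R fb =
    compile-freeBounded _ _ env _ q ρ R (compile-freeBounded P 2≤k env env< p ρ R fb) , λ ()

  previous : ℕ → ℕ → ℕ
  previous k zero    = 0
  previous k (suc j) = j + k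

  previous< : ∀ k j → 2 ≤ k → previous k j < j + k
  previous< k zero    2≤k = 0<k 2≤k
  previous< k (suc j) 2≤k = ℕP.n<1+n (j + k)

  countingChain : ∀ {k} (P : Program k) → 2 ≤ k → (L : ℕ) → Program (L + k)
  countingChain P 2≤k zero = P
  countingChain {k} P 2≤k (suc L) =
    countingChain P 2≤k L ▷ sum (previous k L) 1 (previous< k L 2≤k) (ℕP.<-≤-trans 2≤k (ℕP.m≤n+m k L))

  countingChain-⊑ : ∀ {k} (P : Program k) 2≤k L → P ⊑ countingChain P 2≤k L
  countingChain-⊑ P 2≤k zero    = ⊑-refl
  countingChain-⊑ P 2≤k (suc L) = ⊑-step (countingChain-⊑ P 2≤k L)

  countingChain-freeBounded : ∀ {k} (P : Program k) 2≤k L ρ R → FreeBounded P ρ R →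
                              FreeBounded (countingChain P 2≤k L) ρ R
  countingChain-freeBounded P 2≤k zero    ρ R fb = fb
  countingChain-freeBounded P 2≤k (suc L) ρ R fb = countingChain-freeBounded P 2≤k L ρ R fb , λ ()

  countingChain-value : ∀ {k} (P : Program k) 2≤k L ρ → Satisfies (countingChain P 2≤k L) ρ →
    ρ 0 ≡ + 0 → ρ 1 ≡ + 1 → ∀ j → j < L → ρ (j + k) ≡ + suc j
  countingChain-value {k} P 2≤k (suc L) ρ (sat , step) x₀ x₁ j j<1+L with ℕP.m≤n⇒m<n∨m≡n (ℕ.s≤s⁻¹ j<1+L)
  ... | inj₁ j<L  = countingChain-value P 2≤k L ρ sat x₀ x₁ j j<L
  ... | inj₂ refl =
    trans (sym step) (trans (cong₂ ℤ._+_ (previousValue L j<1+L) x₁)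
                            (trans (sym (ℤP.pos-+ L 1)) (cong +_ (ℕP.+-comm L 1))))
    where
    previousValue : ∀ L′ → L′ < suc L → ρ (previous k L′) ≡ + L′
    previousValue zero     _       = x₀
    previousValue (suc L′) L′<L = countingChain-value P 2≤k L ρ sat x₀ x₁ L′ (ℕ.s≤s⁻¹ L′<L)

module Systems where
  open StraightLine using (Assignment; Equation; one′; add′; mul′; EqHolds)
  open import Data.Nat as ℕ using (ℕ; zero; suc; _≤_; _<_; s≤s)
  open import Data.Integer using (ℤ; +_; -[1+_]; ∣_∣)
  open import Data.Fin using (Fin; toℕ; fromℕ<; fromℕ) renaming (zero to fz; suc to fs)
  import Data.Fin.Properties as FinP
  open import Data.Vec using (Vec; []; _∷_; lookup; tabulate)
  import Data.Vec.Properties as VecP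
  open import Data.List using (List; []; _∷_; _++_; map; concat; upTo)
  open import Data.List.Membership.Propositional using (_∈_)
  open import Data.List.Membership.Propositional.Properties using (∈-map⁺; ∈-++⁺ˡ; ∈-++⁺ʳ; ∈-concat⁺′; ∈-upTo⁺)
  open import Data.List.Relation.Unary.Any using (here)
  open import Data.List.Relation.Unary.All as All using (All)
  import Data.List.Relation.Unary.All.Properties as AllP
  open import Relation.Binary.PropositionalEquality
  open import Relation.Nullary using (yes; no)
  open import Data.Empty using (⊥-elim)

  -- From ℕ-indexed equations to systems S ⊆ E_n with n = suc n′.
  -- Indices beyond the range are clamped (they never occur in our systems).

  index : ∀ n′ → ℕ → Fin (suc n′)
  index n′ i with i ℕ.<? suc n′
  ... | yes i<n = fromℕ< i<n
  ... | no _    = fromℕ n′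

  index-toℕ : ∀ n′ i → i < suc n′ → toℕ (index n′ i) ≡ i
  index-toℕ n′ i i<n with i ℕ.<? suc n′
  ... | yes i<n′ = FinP.toℕ-fromℕ< i<n′
  ... | no i≮n   = ⊥-elim (i≮n i<n)

  index-fin : ∀ n′ (j : Fin (suc n′)) → index n′ (toℕ j) ≡ j
  index-fin n′ j = FinP.toℕ-injective (index-toℕ n′ (toℕ j) (FinP.toℕ<n j))

  toEqn : ∀ n′ → Equation → Eqn (suc n′)
  toEqn n′ (one′ i)     = one (index n′ i)
  toEqn n′ (add′ i j k) = add (index n′ i) (index n′ j) (index n′ k)
  toEqn n′ (mul′ i j k) = mul (index n′ i) (index n′ j) (index n′ k)

  toSystem : ∀ n′ → List Equation → List (Eqn (suc n′))
  toSystem n′ = map (toEqn n′)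

  assignmentOf : ∀ {n′} → Vec ℤ (suc n′) → Assignment
  assignmentOf {n′} x i = lookup x (index n′ i)

  assignmentOf-lookup : ∀ n′ (x : Vec ℤ (suc n′)) (j : Fin (suc n′)) → lookup x j ≡ assignmentOf x (toℕ j)
  assignmentOf-lookup n′ x j = cong (lookup x) (sym (index-fin n′ j))

  vectorOf : ∀ n′ → Assignment → Vec ℤ (suc n′)
  vectorOf n′ ρ = tabulate (λ j → ρ (toℕ j))

  assignmentOf-vectorOf : ∀ n′ ρ i → i < suc n′ → assignmentOf (vectorOf n′ ρ) i ≡ ρ i
  assignmentOf-vectorOf n′ ρ i i<n =
    trans (VecP.lookup∘tabulate (λ j → ρ (toℕ j)) (index n′ i)) (cong ρ (index-toℕ n′ i i<n))

  toSystem-sound : ∀ n′ (es : List Equation) (x : Vec ℤ (suc n′)) →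
                   IsSol (toSystem n′ es) x → All (EqHolds (assignmentOf x)) es
  toSystem-sound n′ es x sol = All.map (λ {e} → holds e) (AllP.map⁻ sol)
    where
    holds : ∀ e → SatEq x (toEqn n′ e) → EqHolds (assignmentOf x) e
    holds (one′ _)     h = h
    holds (add′ _ _ _) h = h
    holds (mul′ _ _ _) h = h

  toSystem-complete : ∀ n′ (es : List Equation) (x : Vec ℤ (suc n′)) →
                      All (EqHolds (assignmentOf x)) es → IsSol (toSystem n′ es) x
  toSystem-complete n′ es x hs = AllP.map⁺ (All.map (λ {e} → holds e) hs)
    where
    holds : ∀ e → EqHolds (assignmentOf x) e → SatEq x (toEqn n′ e)
    holds (one′ _)     h = h
    holds (add′ _ _ _) h = h
    holds (mul′ _ _ _) h = h

  range : ℕ → List ℤ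
  range C = map +_ (upTo (suc C)) ++ map -[1+_] (upTo C)

  ∈-range : ∀ C z → ∣ z ∣ ≤ C → z ∈ range C
  ∈-range C (+ k)    k≤C = ∈-++⁺ˡ (∈-map⁺ +_ (∈-upTo⁺ (s≤s k≤C)))
  ∈-range C -[1+ k ] k<C = ∈-++⁺ʳ (map +_ (upTo (suc C))) (∈-map⁺ -[1+_] (∈-upTo⁺ k<C))

  box : ∀ n → ℕ → List (Vec ℤ n)
  box zero    C = [] ∷ []
  box (suc n) C = concat (map (λ z → map (z ∷_) (box n C)) (range C))

  ∈-box : ∀ n C (x : Vec ℤ n) → (∀ i → ∣ lookup x i ∣ ≤ C) → x ∈ box n C
  ∈-box zero    C []      _       = here refl
  ∈-box (suc n) C (z ∷ x) bounded =
    ∈-concat⁺′ (∈-map⁺ (z ∷_) (∈-box n C x (λ i → bounded (fs i))))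
               (∈-map⁺ (λ z → map (z ∷_) (box n C)) (∈-range C z (bounded fz)))

open GraphRecEnum using (module Graph)
open StraightLine
open Gadgets
open Compile
open Systems
open import Data.Nat as ℕ using (ℕ; zero; suc; _≤_; _<_; s≤s; z≤n; _+_; _∸_)
import Data.Nat.Properties as ℕP
open import Data.Integer as ℤ using (ℤ; +_; ∣_∣)
import Data.Integer.Properties as ℤP
open import Data.Fin using (Fin; toℕ; fromℕ<) renaming (zero to fz; suc to fs)
import Data.Fin.Properties as FinP
open import Data.Vec as Vec using (Vec; []; _∷_; lookup; tabulate)
import Data.Vec.Properties as VecP
open import Data.List using (List; []; _∷_; _++_; map; upTo; length)
import Data.List.Properties as ListP
open import Data.List.Membership.Propositional using (_∈_)
open import Data.List.Membership.Propositional.Properties using (∈-upTo⁻)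
open import Data.List.Relation.Unary.Any using (here; there)
open import Data.List.Relation.Unary.All as All using (All; []; _∷_)
import Data.List.Relation.Unary.All.Properties as AllP
open import Data.List.Relation.Unary.Unique.Propositional using (Unique)
import Data.List.Relation.Unary.Unique.Propositional.Properties as UniqueP
open import Data.Product using (Σ; _,_; _×_; proj₁; proj₂)
open import Data.Unit using (tt)
open import Relation.Binary.PropositionalEquality

-- An upper bound for every entry of every vector in a list.
totalSum : ∀ {k} → List (Vec ℕ k) → ℕ
totalSum []       = 0
totalSum (v ∷ vs) = Vec.sum v + totalSum vs

lookup≤sum : ∀ {k} (v : Vec ℕ k) j → lookup v j ≤ Vec.sum v
lookup≤sum (x ∷ v) fz     = ℕP.m≤m+n x (Vec.sum v)
lookup≤sum (x ∷ v) (fs j) = ℕP.≤-trans (lookup≤sum v j) (ℕP.m≤n+m (Vec.sum v) x)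

∈⇒lookup≤totalSum : ∀ {k} (v : Vec ℕ k) vs j → v ∈ vs → lookup v j ≤ totalSum vs
∈⇒lookup≤totalSum v (w ∷ vs) j (here refl) = ℕP.≤-trans (lookup≤sum v j) (ℕP.m≤m+n (Vec.sum v) (totalSum vs))
∈⇒lookup≤totalSum v (w ∷ vs) j (there v∈) = ℕP.≤-trans (∈⇒lookup≤totalSum v vs j v∈) (ℕP.m≤n+m (totalSum vs) (Vec.sum w))

-- The entry j of a vector, and 0 beyond its length.
valueAt : ∀ {k} → Vec ℕ k → ℕ → ℕ
valueAt []       _       = 0
valueAt (x ∷ xs) zero    = x
valueAt (x ∷ xs) (suc j) = valueAt xs j

valueAt-lookup : ∀ {k} (xs : Vec ℕ k) (j : Fin k) → valueAt xs (toℕ j) ≡ lookup xs j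
valueAt-lookup (x ∷ xs) fz     = refl
valueAt-lookup (x ∷ xs) (fs j) = valueAt-lookup xs j

-- Variables, in order:  x₀ = 0, x₁ = 1, a free variable a (position 2);
-- a gadget with value b (position 13); m gadgets holding the unknowns
-- x⃗ of W; gadgets with values z and w; the compiled polynomial
-- W(a, b, x⃗), output at position r; and a counting chain 1, 2, …, L+1.
-- The system consists of these equations and three checks:
--   x_{L+K} + x_{pred K + K} = a   (forcing a = n, the number of variables)
--   W(a, b, x⃗) = 0                 (so b = f(n) and x⃗ is one of finitely many)
--   z + w = b                       (z ranges over 0 … f(n))

module Construction (conjecture : MatiyasevichConjecture) (f : ℕ → ℕ) (computable : Computable f) where
  open Graph f computable

  representation : Σ ℕ λ m → Σ (Poly (2 + m)) λ W → DiophRep 2 m graph W × FiniteFold 2 m W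
  representation = conjecture 2 (s≤s z≤n) graph graph-recEnum

  m : ℕ
  m = proj₁ representation

  W : Poly (2 + m)
  W = proj₁ (proj₂ representation)

  W-represents : DiophRep 2 m graph W
  W-represents = proj₁ (proj₂ (proj₂ representation))

  W-finiteFold : FiniteFold 2 m W
  W-finiteFold = proj₂ (proj₂ (proj₂ representation))

  base : Program 3
  base = [] ▷ isZero ▷ isOne ▷ free

  withB : Program 14
  withB = squareSumGadget base

  P : ℕ
  P = gadgetStart 14 m

  withXs : Program P
  withXs = gadgets withB m

  withZ : Program (11 + P)
  withZ = squareSumGadget withXs

  K₄ : ℕ
  K₄ = 11 + (11 + P)

  withW : Program K₄
  withW = squareSumGadget withZ

  zPos wPos : ℕ
  zPos = 10 + P
  wPos = 10 + (11 + P)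

  14≤P : 14 ≤ P
  14≤P = gadgetStart-mono withB {0} {m} z≤n

  P≤K₄ : P ≤ K₄
  P≤K₄ = ℕP.≤-trans (ℕP.m≤n+m P 11) (ℕP.m≤n+m (11 + P) 11)

  14≤K₄ : 14 ≤ K₄
  14≤K₄ = ℕP.≤-trans 14≤P P≤K₄

  env : Fin (2 + m) → ℕ
  env fz           = 2
  env (fs fz)      = 13
  env (fs (fs j))  = valuePos 14 (toℕ j)

  env< : ∀ v → env v < K₄
  env< fz          = ℕP.<-≤-trans (s≤s (s≤s (s≤s z≤n))) 14≤K₄
  env< (fs fz)     = 14≤K₄
  env< (fs (fs j)) = ℕP.<-≤-trans (valuePos< withB (FinP.toℕ<n j)) P≤K₄

  compiledW : Compiled withW
  compiledW = compile withW (ℕP.≤-trans (s≤s (s≤s z≤n)) 14≤K₄) env env< W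

  K r : ℕ
  K = size compiledW
  r = output compiledW

  K₄≤K : K₄ ≤ K
  K₄≤K = ⊑-length (prefix compiledW)

  2≤K : 2 ≤ K
  2≤K = ℕP.≤-trans (ℕP.≤-trans (s≤s (s≤s z≤n)) 14≤K₄) K₄≤K

  full : (L : ℕ) → Program (suc L + K)
  full L = countingChain (program compiledW) 2≤K (suc L)

  checks : ℕ → List Equation
  checks L = add′ (L + K) (ℕ.pred K + K) 2 ∷ add′ r r r ∷ add′ zPos wPos 13 ∷ []

  system : (L : ℕ) → System (suc (L + K))
  system L = toSystem (L + K) (checks L ++ equations (full L))

  withW⊑full : ∀ L → withW ⊑ full L
  withW⊑full L = ⊑-trans (prefix compiledW) (countingChain-⊑ (program compiledW) 2≤K (suc L))

  suc-pred-K : suc (ℕ.pred K) ≡ K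
  suc-pred-K = ℕP.suc-pred K {{ℕ.>-nonZero (ℕP.<-≤-trans (s≤s z≤n) 2≤K)}}

  module Solution (L : ℕ) (ρ : Assignment) (sat : Satisfies (full L) ρ) where
    satCompiled : Satisfies (program compiledW) ρ
    satCompiled = ⊑-satisfies (countingChain-⊑ (program compiledW) 2≤K (suc L)) ρ sat

    satW : Satisfies withW ρ
    satW = ⊑-satisfies (withW⊑full L) ρ sat

    satZ : Satisfies withZ ρ
    satZ = ⊑-satisfies (gadget-⊑ withZ) ρ satW

    satXs : Satisfies withXs ρ
    satXs = ⊑-satisfies (gadget-⊑ withXs) ρ satZ

    satB : Satisfies withB ρ
    satB = ⊑-satisfies (gadgets-⊑ withB {0} {m} z≤n) ρ satXs

    x₀≡0 : ρ 0 ≡ + 0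
    x₀≡0 = idempotent⇒zero (ρ 0) (proj₂ (proj₁ (proj₁ (⊑-satisfies (gadget-⊑ base) ρ satB))))

    x₁≡1 : ρ 1 ≡ + 1
    x₁≡1 = proj₂ (proj₁ (⊑-satisfies (gadget-⊑ base) ρ satB))

    -- The first check reads  (L + 1) + K = a.
    countingSum : ℕ.pred K ≤ L → ρ (L + K) ℤ.+ ρ (ℕ.pred K + K) ≡ + suc (L + K)
    countingSum pred-K≤L =
      trans (cong₂ ℤ._+_ (chain L ℕP.≤-refl) (chain (ℕ.pred K) (s≤s pred-K≤L)))
            (trans (sym (ℤP.pos-+ (suc L) (suc (ℕ.pred K)))) (cong (λ t → + (suc L + t)) suc-pred-K))
      where
      chain : ∀ j → j < suc L → ρ (j + K) ≡ + suc j
      chain = countingChain-value (program compiledW) 2≤K (suc L) ρ sat x₀≡0 x₁≡1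

    outputValue : ∀ a b (xs : Vec ℕ m) → ρ 2 ≡ + a → ρ 13 ≡ + b →
      (∀ j → ρ (valuePos 14 (toℕ j)) ≡ + lookup xs j) → ρ r ≡ evalℕ W (a ∷ b ∷ []) xs
    outputValue a b xs ρ₂ ρ₁₃ ρxs =
      compile-value withW _ env env< W ρ satCompiled x₀≡0 x₁≡1 (Vec.map +_ ((a ∷ b ∷ []) Vec.++ xs)) reads
      where
      reads : ∀ v → lookup (Vec.map +_ ((a ∷ b ∷ []) Vec.++ xs)) v ≡ ρ (env v)
      reads fz          = sym ρ₂
      reads (fs fz)     = sym ρ₁₃
      reads (fs (fs j)) = trans (VecP.lookup-map j +_ xs) (sym (ρxs j))

  witnesses : ℕ → List (Vec ℕ m)
  witnesses n = proj₁ (W-finiteFold (n ∷ f n ∷ []))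

  solutionBound : ℕ → ℕ
  solutionBound n = n + (f n + totalSum (witnesses n))

  -- Soundness: a solution satisfies a = n and b = f(n); its W-unknowns form one
  -- of the finitely many witnesses.  Hence all free variables are bounded.
  module Bounded (L : ℕ) (pred-K≤L : ℕ.pred K ≤ L) (x : Vec ℤ (suc (L + K))) (sol : IsSol (system L) x) where
    n : ℕ
    n = suc (L + K)

    ρ : Assignment
    ρ = assignmentOf x

    holds : All (EqHolds ρ) (checks L ++ equations (full L))
    holds = toSystem-sound (L + K) (checks L ++ equations (full L)) x sol

    sat : Satisfies (full L) ρ
    sat = equations⇒ (full L) ρ (AllP.++⁻ʳ (checks L) holds)

    open Solution L ρ sat

    checksHold : All (EqHolds ρ) (checks L)
    checksHold = AllP.++⁻ˡ (checks L) holds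

    a≡n : ρ 2 ≡ + n
    a≡n = trans (sym (All.head checksHold)) (countingSum pred-K≤L)

    r≡0 : ρ r ≡ + 0
    r≡0 = idempotent⇒zero (ρ r) (All.head (All.tail checksHold))

    z+w≡b : ρ zPos ℤ.+ ρ wPos ≡ ρ 13
    z+w≡b = All.head (All.tail (All.tail checksHold))

    qb qz qw : ℕ
    qb = rootNorm ρ 3
    qz = rootNorm ρ P
    qw = rootNorm ρ (11 + P)

    qx : Vec ℕ m
    qx = tabulate (λ j → rootNorm ρ (gadgetStart 14 (toℕ j)))

    xs≡qx : ∀ j → ρ (valuePos 14 (toℕ j)) ≡ + lookup qx j
    xs≡qx j = trans (gadgets-natural withB m ρ satXs (toℕ j) (FinP.toℕ<n j))
                    (cong +_ (sym (VecP.lookup∘tabulate (λ j → rootNorm ρ (gadgetStart 14 (toℕ j))) j)))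

    W-root : evalℕ W (n ∷ qb ∷ []) qx ≡ + 0
    W-root = trans (sym (outputValue n qb qx a≡n (gadget-natural base ρ satB) xs≡qx)) r≡0

    qb≡fn : qb ≡ f n
    qb≡fn = proj₂ (W-represents (n ∷ qb ∷ [])) (qx , W-root)

    qx∈witnesses : qx ∈ witnesses n
    qx∈witnesses = proj₂ (W-finiteFold (n ∷ f n ∷ [])) qx
                         (subst (λ b → evalℕ W (n ∷ b ∷ []) qx ≡ + 0) qb≡fn W-root)

    qz+qw≡fn : qz + qw ≡ f n
    qz+qw≡fn = trans (ℤP.+-injective (trans (ℤP.pos-+ qz qw)
                 (trans (sym (cong₂ ℤ._+_ (gadget-natural withXs ρ satZ) (gadget-natural withZ ρ satW)))
                 (trans z+w≡b (gadget-natural base ρ satB))))) qb≡fn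

    R : ℕ
    R = solutionBound n

    fn≤R : f n ≤ R
    fn≤R = ℕP.≤-trans (ℕP.m≤m+n (f n) _) (ℕP.m≤n+m _ n)

    xRoots : ∀ j → j < m → RootsBounded ρ (gadgetStart 14 j) R
    xRoots j j<m = RootsBounded-mono ρ _ (ℕP.≤-trans qj≤total total≤R) (rootNorm-bounds ρ _)
      where
      qj≤total : rootNorm ρ (gadgetStart 14 j) ≤ totalSum (witnesses n)
      qj≤total = subst (_≤ totalSum (witnesses n))
        (trans (VecP.lookup∘tabulate (λ j → rootNorm ρ (gadgetStart 14 (toℕ j))) (fromℕ< j<m))
               (cong (λ i → rootNorm ρ (gadgetStart 14 i)) (FinP.toℕ-fromℕ< j<m)))
        (∈⇒lookup≤totalSum qx (witnesses n) (fromℕ< j<m) qx∈witnesses)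
      total≤R : totalSum (witnesses n) ≤ R
      total≤R = ℕP.≤-trans (ℕP.m≤n+m _ (f n)) (ℕP.m≤n+m _ n)

    freeBounded : FreeBounded (full L) ρ R
    freeBounded =
      countingChain-freeBounded (program compiledW) 2≤K (suc L) ρ R
        (compile-freeBounded withW _ env env< W ρ R
          (gadget-freeBounded withZ ρ R
            (gadget-freeBounded withXs ρ R
              (gadgets-freeBounded withB m ρ R
                (gadget-freeBounded base ρ R aBounded
                  (RootsBounded-mono ρ 3 (ℕP.≤-trans (ℕP.≤-reflexive qb≡fn) fn≤R) (rootNorm-bounds ρ 3)))
                xRoots)
              (RootsBounded-mono ρ P (ℕP.≤-trans (subst (qz ≤_) qz+qw≡fn (ℕP.m≤m+n qz qw)) fn≤R)
                                 (rootNorm-bounds ρ P)))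
            (RootsBounded-mono ρ (11 + P) (ℕP.≤-trans (subst (qw ≤_) qz+qw≡fn (ℕP.m≤n+m qw qz)) fn≤R)
                               (rootNorm-bounds ρ (11 + P)))))
      where
      aBounded : FreeBounded base ρ R
      aBounded = ((tt , λ ()) , λ ()) , λ _ → subst (λ t → ∣ t ∣ ≤ R) (sym a≡n) (ℕP.m≤m+n n _)

    entries-bounded : ∀ j → ∣ lookup x j ∣ ≤ growth R n
    entries-bounded j = subst (λ t → ∣ t ∣ ≤ growth R n) (sym (assignmentOf-lookup (L + K) x j))
                              (bounded (full L) ρ R sat freeBounded (toℕ j) (FinP.toℕ<n j))

  finitelyMany : ∀ L → ℕ.pred K ≤ L → FinitelyManySols (system L)
  finitelyMany L pred-K≤L =
    box (suc (L + K)) (growth (solutionBound (suc (L + K))) (suc (L + K))) ,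
    λ x sol → ∈-box _ _ x (Bounded.entries-bounded L pred-K≤L x sol)

  zPos<K₄ : zPos < K₄
  zPos<K₄ = ℕP.<-≤-trans (ℕP.n<1+n zPos) (ℕP.m≤n+m (11 + P) 11)

  wPos<K₄ : wPos < K₄
  wPos<K₄ = ℕP.n<1+n wPos

  -- The variables are
  -- filled in order: a = n, b = f(n), x⃗ = a witness of W(n, f n, x⃗) = 0,
  -- z = t, w = f(n) − t, and the remaining variables are computed.
  module Existence (L : ℕ) (pred-K≤L : ℕ.pred K ≤ L) where
    n : ℕ
    n = suc (L + K)

    below-n : ∀ {i} → i < K₄ → i < n
    below-n i<K₄ = ℕP.<-trans (ℕP.<-≤-trans i<K₄ K₄≤K) (s≤s (ℕP.m≤n+m K L))

    witness : Vec ℕ m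
    witness = proj₁ (proj₁ (W-represents (n ∷ f n ∷ [])) refl)

    witness-root : evalℕ W (n ∷ f n ∷ []) witness ≡ + 0
    witness-root = proj₂ (proj₁ (W-represents (n ∷ f n ∷ [])) refl)

    module Assemble (t : ℕ) where
      ρ₀ : Assignment
      ρ₀ = run base (λ _ → + n)

      stepB : Σ (Extends base withB ρ₀) λ e → proj₁ e 13 ≡ + f n
      stepB = extendWithValue base ρ₀ (run-satisfies base (λ _ → + n)) (f n)

      ρ₁ : Assignment
      ρ₁ = proj₁ (proj₁ stepB)

      stepXs : Σ (Extends withB withXs ρ₁) λ e → ∀ j → j < m → proj₁ e (valuePos 14 j) ≡ + valueAt witness j
      stepXs = extendWithValues withB (valueAt witness) m ρ₁ (proj₁ (proj₂ (proj₁ stepB)))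

      ρ₂ : Assignment
      ρ₂ = proj₁ (proj₁ stepXs)

      stepZ : Σ (Extends withXs withZ ρ₂) λ e → proj₁ e zPos ≡ + t
      stepZ = extendWithValue withXs ρ₂ (proj₁ (proj₂ (proj₁ stepXs))) t

      ρ₃ : Assignment
      ρ₃ = proj₁ (proj₁ stepZ)

      stepW : Σ (Extends withZ withW ρ₃) λ e → proj₁ e wPos ≡ + (f n ∸ t)
      stepW = extendWithValue withZ ρ₃ (proj₁ (proj₂ (proj₁ stepZ))) (f n ∸ t)

      ρ₄ : Assignment
      ρ₄ = proj₁ (proj₁ stepW)

      ρ₅ : Assignment
      ρ₅ = run (full L) ρ₄

      step₅ : Satisfies (full L) ρ₅ × Agree K₄ ρ₅ ρ₄
      step₅ = extend (withW⊑full L) ρ₄ ρ₄ (proj₁ (proj₂ (proj₁ stepW))) (λ _ _ → refl)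

      agree₃ : Agree (11 + P) ρ₅ ρ₃
      agree₃ = agree-trans (ℕP.m≤n+m (11 + P) 11) (proj₂ step₅) (proj₂ (proj₂ (proj₁ stepW)))

      agree₂ : Agree P ρ₅ ρ₂
      agree₂ = agree-trans (ℕP.m≤n+m P 11) agree₃ (proj₂ (proj₂ (proj₁ stepZ)))

      agree₁ : Agree 14 ρ₅ ρ₁
      agree₁ = agree-trans 14≤P agree₂ (proj₂ (proj₂ (proj₁ stepXs)))

      agree₀ : Agree 3 ρ₅ ρ₀
      agree₀ = agree-trans (s≤s (s≤s (s≤s z≤n))) agree₁ (proj₂ (proj₂ (proj₁ stepB)))

      open Solution L ρ₅ (proj₁ step₅)

      a≡n : ρ₅ 2 ≡ + n
      a≡n = trans (agree₀ 2 (s≤s (s≤s (s≤s z≤n)))) (run-free {P = [] ▷ isZero ▷ isOne} ⊑-refl (λ _ → + n))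

      b≡fn : ρ₅ 13 ≡ + f n
      b≡fn = trans (agree₁ 13 ℕP.≤-refl) (proj₂ stepB)

      xs≡witness : ∀ j → ρ₅ (valuePos 14 (toℕ j)) ≡ + lookup witness j
      xs≡witness j = trans (agree₂ _ (valuePos< withB (FinP.toℕ<n j)))
                           (trans (proj₂ stepXs (toℕ j) (FinP.toℕ<n j)) (cong +_ (valueAt-lookup witness j)))

      z≡t : ρ₅ zPos ≡ + t
      z≡t = trans (agree₃ zPos (ℕP.n<1+n zPos)) (proj₂ stepZ)

      w≡fn-t : ρ₅ wPos ≡ + (f n ∸ t)
      w≡fn-t = trans (proj₂ step₅ wPos wPos<K₄) (proj₂ stepW)

      r≡0 : ρ₅ r ≡ + 0
      r≡0 = trans (outputValue n (f n) witness a≡n b≡fn xs≡witness) witness-root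

      checksHold : t ≤ f n → All (EqHolds ρ₅) (checks L)
      checksHold t≤fn =
        trans (countingSum pred-K≤L) (sym a≡n) ∷
        trans (cong₂ ℤ._+_ r≡0 r≡0) (sym r≡0) ∷
        trans (cong₂ ℤ._+_ z≡t w≡fn-t)
              (trans (sym (ℤP.pos-+ t (f n ∸ t))) (trans (cong +_ (ℕP.m+[n∸m]≡n t≤fn)) (sym b≡fn))) ∷ []

      checks-indices : All (IndicesBelow n) (checks L)
      checks-indices =
        (ℕP.n<1+n (L + K) , s≤s (ℕP.+-monoˡ-≤ K pred-K≤L) , below-n (ℕP.<-≤-trans (s≤s (s≤s (s≤s z≤n))) 14≤K₄)) ∷
        (r<n , r<n , r<n) ∷
        (below-n zPos<K₄ , below-n wPos<K₄ , below-n 14≤K₄) ∷ []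
        where
        r<n : r < n
        r<n = ℕP.<-trans (output< compiledW) (s≤s (ℕP.m≤n+m K L))

      vector : Vec ℤ n
      vector = vectorOf (L + K) ρ₅

      vector-agrees : Agree n ρ₅ (assignmentOf vector)
      vector-agrees i i<n = sym (assignmentOf-vectorOf (L + K) ρ₅ i i<n)

      vector-isSol : t ≤ f n → IsSol (system L) vector
      vector-isSol t≤fn = toSystem-complete (L + K) (checks L ++ equations (full L)) vector
        (AllP.++⁺ (equationsHold-local (checks L) ρ₅ (assignmentOf vector) checks-indices vector-agrees (checksHold t≤fn))
                  (equations⇐ (full L) (assignmentOf vector)
                     (satisfies-local (full L) ρ₅ (assignmentOf vector) vector-agrees (proj₁ step₅))))

      vector-z : lookup vector (fromℕ< (below-n zPos<K₄)) ≡ + t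
      vector-z = trans (VecP.lookup∘tabulate (λ j → ρ₅ (toℕ j)) (fromℕ< (below-n zPos<K₄)))
                       (trans (cong ρ₅ (FinP.toℕ-fromℕ< (below-n zPos<K₄))) z≡t)

    zIndex : Fin n
    zIndex = fromℕ< (below-n zPos<K₄)

    solution : ℕ → Vec ℤ n
    solution t = Assemble.vector t

    -- Different t give different solutions: the z-coordinate is t.
    solution-injective : ∀ {t t′} → solution t ≡ solution t′ → t ≡ t′
    solution-injective {t} {t′} eq =
      ℤP.+-injective (trans (sym (Assemble.vector-z t)) (trans (cong (λ v → lookup v zIndex) eq) (Assemble.vector-z t′)))

    solutions : List (Vec ℤ n)
    solutions = map solution (upTo (suc (f n)))

    solutions-valid : All (IsSol (system L)) solutions
    solutions-valid = AllP.map⁺ {P = IsSol (system L)} {f = solution}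
      (All.tabulate (λ {t} t∈ → Assemble.vector-isSol t (ℕ.s≤s⁻¹ (∈-upTo⁻ t∈))))

    solutions-length : f n ≤ length solutions
    solutions-length = ℕP.≤-trans (ℕP.n≤1+n (f n))
      (ℕP.≤-reflexive (sym (trans (ListP.length-map solution (upTo (suc (f n)))) (ListP.length-upTo (suc (f n))))))

    solutions-unique : Unique solutions
    solutions-unique = UniqueP.map⁺ {f = solution} solution-injective (UniqueP.upTo⁺ (suc (f n)))

    atLeast : AtLeastSols (f n) (system L)
    atLeast = solutions , solutions-unique , solutions-length , solutions-valid

-- The theorem: m(f) = 2K works, writing each n ≥ 2K as n = (L + 1) + K with
-- K − 1 ≤ L.

theorem1 : MatiyasevichConjecture → (f : ℕ → ℕ) → Computable f →
    Σ ℕ λ m → 1 ≤ m × (∀ n → m ≤ n →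
      Σ (System n) λ S → AtLeastSols (f n) S × FinitelyManySols S)
theorem1 conjecture f computable = K + K , ℕP.≤-trans (ℕP.≤-trans (s≤s z≤n) 2≤K) (ℕP.m≤m+n K K) , systemFor
  where
  open Construction conjecture f computable
  systemFor : ∀ n → K + K ≤ n → Σ (System n) λ S → AtLeastSols (f n) S × FinitelyManySols S
  systemFor n 2K≤n =
    subst (λ n → Σ (System n) λ S → AtLeastSols (f n) S × FinitelyManySols S) n≡
          (system L , Existence.atLeast L pred-K≤L , finitelyMany L pred-K≤L)
    where
    L : ℕ
    L = n ∸ suc K
    1+K≤n : suc K ≤ n
    1+K≤n = ℕP.≤-trans (subst (_≤ K + K) (ℕP.+-comm K 1) (ℕP.+-monoʳ-≤ K (ℕP.≤-trans (s≤s z≤n) 2≤K))) 2K≤n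
    n≡ : suc (L + K) ≡ n
    n≡ = trans (sym (ℕP.+-suc L K)) (ℕP.m∸n+n≡m 1+K≤n)
    pred-K≤L : ℕ.pred K ≤ L
    pred-K≤L = ℕP.m+n≤o⇒m≤o∸n (ℕ.pred K)
      (subst (_≤ n) (trans (cong (_+ K) (sym suc-pred-K)) (sym (ℕP.+-suc (ℕ.pred K) K))) 2K≤n)
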